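{- If $\emptyset\vdash M:(v,\mathsf{r})$ is derivable, where $M$ is a finite closed lambda-term of sort $\mathsf{o}$ that is not in beta-normal form, then $\emptyset\vdash N:(v',\mathsf{r})$ is derivable for some lambda-term $N$ with $M\to_\beta N$ (one beta-reduction step) and some $v'$ satisfying, for all $a\in\Sigma_{\mathsf{a}}$, $v(a)\le v'(a)$ and ($v(a)=0\Rightarrow v'(a)=0$).
   Context: Fix $s\ge1$. Sorts are built from $\mathsf{o}$ by $\to$. Lambda-terms are simply-typed lambda-terms, up to alpha-conversion, over constants $\mathsf{a}_1,\dots,\mathsf{a}_s:\mathsf{o}\to\mathsf{o}$ (important constants, $\Sigma_{\mathsf{a}}=\{\mathsf{a}_1,\dots,\mathsf{a}_s\}$), $\mathsf{b}:\mathsf{o}\to\mathsf{o}\to\mathsf{o}$, $\mathsf{c},\omega:\mathsf{o}$. An $s$-multiset is a multiset with at most $s$ copies of each element; $\mathcal{P}_{\le s}(X)$ is the set of $s$-multisets of elements of $X$; the union $U\cup V$ of $s$-multisets contains $\min(n+m,s)$ copies of an element occurring $n$ times in $U$ and $m$ times in $V$; $\{x_i\mid i\in I\}$ denotes $\bigcup_{i\in I}\{x_i\}$ in this sense. Types: $\mathcal{T}_s^{\mathsf{o}}=\{\mathsf{r}\}$, $\mathcal{T}_s^{\alpha\to\beta}=\mathcal{P}_{\le s}(\mathcal{P}(\Sigma_{\mathsf{a}})\times\mathcal{T}_s^\alpha)\times\mathcal{T}_s^\beta$, written $\bigwedge_{i\in I}(A_i,\tau_i)\to\tau$ where each pair occurs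 as $(A_i,\tau_i)$ for at most $s$ indices; $\top$ is the empty one. Judgments $\Gamma\vdash M:(v,\tau)$ with $v:\Sigma_{\mathsf{a}}\to\mathbb{N}$, $\tau$ of the sort of $M$, $\Gamma$ an $s$-multiset of bindings $x:(A,\sigma)$ with $A\subseteq\Sigma_{\mathsf{a}}$ and $\sigma$ of the sort of $x$; $\mathit{dom}(\Gamma)$ is the set of bound variables; $\Gamma{\restriction}_a$ is the $s$-multiset of bindings of $\Gamma$ whose set contains $a$. $\mathbf{0}$ maps all of $\Sigma_{\mathsf{a}}$ to $0$; $\chi_i$ maps $\mathsf{a}_i$ to $1$ and the others to $0$; $\mathit{dupl}((\Gamma_j)_{j\in J})(a)=\sum_{j\in J}|\Gamma_j{\restriction}_a|-|\bigcup_{j\in J}\Gamma_j{\restriction}_a|$. Finite derivations use the rules: $\emptyset\vdash\mathsf{a}_i:(\chi_i,(A,\mathsf{r})\to\mathsf{r})$; $\emptyset\vdash\mathsf{c}:(\mathbf{0},\mathsf{r})$; $\emptyset\vdash\mathsf{b}:(\mathbf{0},(A,\mathsf{r})\to\top\to\mathsf{r})$; $\emptyset\vdash\mathsf{b}:(\mathbf{0},\top\to(A,\mathsf{r})\to\mathsf{r})$ (any $A$); $x:(A,\tau)\vdash x:(\mathbf{0},\tau)$; ($\lambda$): from $\Gamma\cup\{x:(A_i,\tau_i)\mid i\in I\}\vdash K:(v,\tau)$ with $x\notin\mathit{dom}(\Gamma)$ infer $\Gamma\vdash\lambda x.K:(v,\bigwedge_{i\in I}(A_i,\tau_i)\to\tau)$;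 ($@$): if $0\notin I$, $\Gamma_0\vdash K:(v_0,\bigwedge_{i\in I}(A_i,\tau_i)\to\tau)$, and for each $i\in I$, $\Gamma_i\vdash L:(v_i,\tau_i)$ with $A_i=\{a\in\Sigma_{\mathsf{a}}\mid v_i(a)>0\lor\Gamma_i{\restriction}_a\ne\emptyset\}$, infer $\bigcup_{i\in\{0\}\cup I}\Gamma_i\vdash K\,L:(\mathit{dupl}((\Gamma_i)_{i\in\{0\}\cup I})+\sum_{i\in\{0\}\cup I}v_i,\tau)$. No rule for $\omega$. -}

module Defs where

open import Data.Nat using (ℕ; zero; suc; _+_; _*_; _∸_; _^_; _⊓_; _≡ᵇ_; s≤s)
open import Data.Nat.Properties using (m⊓n≤n)
open import Data.Fin using (Fin; zero; suc; toℕ; fromℕ<; combine; remQuot)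
open import Data.Vec using (Vec; []; _∷_; lookup; replicate; tabulate; zipWith; sum; _[_]≔_)
open import Data.Bool using (Bool; true; false; not; _∨_)
open import Data.Product using (Σ; _×_; _,_; proj₁; proj₂)
open import Data.Unit using (⊤; tt)
open import Data.List using (List; []; _∷_)
open import Relation.Nullary using (¬_)
open import Relation.Binary.PropositionalEquality using (_≡_)

infixr 7 _⇒_
data Sort : Set where
  o   : Sort
  _⇒_ : Sort → Sort → Sort

Ctx : Set
Ctx = List Sort

-- de Bruijn variables (terms are taken up to alpha-conversion)
data _∋_ : Ctx → Sort → Set where
  here  : ∀ {Δ σ} → (σ ∷ Δ) ∋ σ
  there : ∀ {Δ σ τ} → Δ ∋ σ → (τ ∷ Δ) ∋ σ

-- Everything below is parameterised by s (number of important constants,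
-- which is also the multiplicity bound of s-multisets).

module _ (s : ℕ) where

  -- Simply-typed lambda-terms (intrinsically sorted, de Bruijn; finite)
  -- over a_1..a_s : o→o (aC i), b : o→o→o, c : o, ω : o.

  data Tm (Δ : Ctx) : Sort → Set where
    var : ∀ {σ} → Δ ∋ σ → Tm Δ σ
    aC  : Fin s → Tm Δ (o ⇒ o)
    bC  : Tm Δ (o ⇒ o ⇒ o)
    cC  : Tm Δ o
    ωC  : Tm Δ o
    lam : ∀ {σ τ} → Tm (σ ∷ Δ) τ → Tm Δ (σ ⇒ τ)
    app : ∀ {σ τ} → Tm Δ (σ ⇒ τ) → Tm Δ σ → Tm Δ τ

  Ren : Ctx → Ctx → Set
  Ren Δ Δ' = ∀ {σ} → Δ ∋ σ → Δ' ∋ σ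

  extR : ∀ {Δ Δ' τ} → Ren Δ Δ' → Ren (τ ∷ Δ) (τ ∷ Δ')
  extR ρ here      = here
  extR ρ (there x) = there (ρ x)

  rename : ∀ {Δ Δ' σ} → Ren Δ Δ' → Tm Δ σ → Tm Δ' σ
  rename ρ (var x)   = var (ρ x)
  rename ρ (aC i)    = aC i
  rename ρ bC        = bC
  rename ρ cC        = cC
  rename ρ ωC        = ωC
  rename ρ (lam K)   = lam (rename (extR ρ) K)
  rename ρ (app K L) = app (rename ρ K) (rename ρ L)

  Sub : Ctx → Ctx → Set
  Sub Δ Δ' = ∀ {σ} → Δ ∋ σ → Tm Δ' σ

  extS : ∀ {Δ Δ' τ} → Sub Δ Δ' → Sub (τ ∷ Δ) (τ ∷ Δ')
  extS θ here      = var here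
  extS θ (there x) = rename there (θ x)

  subst : ∀ {Δ Δ' σ} → Sub Δ Δ' → Tm Δ σ → Tm Δ' σ
  subst θ (var x)   = θ x
  subst θ (aC i)    = aC i
  subst θ bC        = bC
  subst θ cC        = cC
  subst θ ωC        = ωC
  subst θ (lam K)   = lam (subst (extS θ) K)
  subst θ (app K L) = app (subst θ K) (subst θ L)

  _[_] : ∀ {Δ σ τ} → Tm (σ ∷ Δ) τ → Tm Δ σ → Tm Δ τ
  _[_] {Δ} {σ} K L = subst θ K
    where
    θ : Sub (σ ∷ Δ) Δ
    θ here      = L
    θ (there x) = var x

  data _⟶β_ {Δ : Ctx} : ∀ {σ} → Tm Δ σ → Tm Δ σ → Set where
    beta : ∀ {σ τ} {K : Tm (σ ∷ Δ) τ} {L : Tm Δ σ} → app (lam K) L ⟶β (K [ L ])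
    ξlam : ∀ {σ τ} {K K' : Tm (σ ∷ Δ) τ} → K ⟶β K' → lam K ⟶β lam K'
    ξl   : ∀ {σ τ} {K K' : Tm Δ (σ ⇒ τ)} {L : Tm Δ σ} → K ⟶β K' → app K L ⟶β app K' L
    ξr   : ∀ {σ τ} {K : Tm Δ (σ ⇒ τ)} {L L' : Tm Δ σ} → L ⟶β L' → app K L ⟶β app K L'

  data HasRedex {Δ : Ctx} : ∀ {σ} → Tm Δ σ → Set where
    redex : ∀ {σ τ} {K : Tm (σ ∷ Δ) τ} {L : Tm Δ σ} → HasRedex (app (lam K) L)
    inLam : ∀ {σ τ} {K : Tm (σ ∷ Δ) τ} → HasRedex K → HasRedex (lam K)
    inL   : ∀ {σ τ} {K : Tm Δ (σ ⇒ τ)} {L : Tm Δ σ} → HasRedex K → HasRedex (app K L)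
    inR   : ∀ {σ τ} {K : Tm Δ (σ ⇒ τ)} {L : Tm Δ σ} → HasRedex L → HasRedex (app K L)

  BetaNormal : ∀ {Δ σ} → Tm Δ σ → Set
  BetaNormal M = ¬ HasRedex M

  -- subsets of Σ_a = {a_1..a_s}, as Data.Fin.Subset-style Bool vectors
  Subset : Set
  Subset = Vec Bool s

  bit : Bool → Fin 2
  bit false = zero
  bit true  = suc zero

  codeSub : ∀ {n} → Vec Bool n → Fin (2 ^ n)
  codeSub []       = zero
  codeSub (b ∷ bs) = combine (bit b) (codeSub bs)

  decodeSub : ∀ n → Fin (2 ^ n) → Vec Bool n
  decodeSub zero    i = []
  decodeSub (suc n) i with remQuot {2} (2 ^ n) i
  ... | b , j = (toℕ b ≡ᵇ 1) ∷ decodeSub n j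

  codeVec : ∀ {k n} → Vec (Fin k) n → Fin (k ^ n)
  codeVec []       = zero
  codeVec (x ∷ xs) = combine x (codeVec xs)

  decodeVec : ∀ k n → Fin (k ^ n) → Vec (Fin k) n
  decodeVec k zero    i = []
  decodeVec k (suc n) i with remQuot {k} (k ^ n) i
  ... | x , j = x ∷ decodeVec k n j

  -- Types T_s^α.  An s-multiset over P(Σ_a) × T_s^α is represented
  -- canonically by its multiplicity vector (values 0..s), indexed by the
  -- code of the pair (A , τ).

  card : Sort → ℕ
  card o       = 1
  card (α ⇒ β) = (suc s) ^ (2 ^ s * card α) * card β

  record Mult (α : Sort) : Set where
    constructor mult
    field mults : Vec (Fin (suc s)) (2 ^ s * card α)
  open Mult public

  Ty : Sort → Set
  Ty o       = ⊤
  Ty (α ⇒ β) = Mult α × Ty β      -- (m , τ) is  ⋀ m → τ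

  r : Ty o
  r = tt

  codeTy : ∀ α → Ty α → Fin (card α)
  codeTy o       t       = zero
  codeTy (α ⇒ β) (m , τ) = combine (codeVec (mults m)) (codeTy β τ)

  decodeTy : ∀ α → Fin (card α) → Ty α
  decodeTy o       i = tt
  decodeTy (α ⇒ β) i with remQuot {(suc s) ^ (2 ^ s * card α)} (card β) i
  ... | p , q = mult (decodeVec (suc s) (2 ^ s * card α) p) , decodeTy β q

  pairIdx : ∀ {α} → Subset → Ty α → Fin (2 ^ s * card α)
  pairIdx {α} A τ = combine (codeSub A) (codeTy α τ)

  pairOf : ∀ {α} → Fin (2 ^ s * card α) → Subset × Ty α
  pairOf {α} i with remQuot {2 ^ s} (card α) i
  ... | p , q = decodeSub s p , decodeTy α q

  -- multiplicity arithmetic in s-multisets: min(n , s)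
  capFin : ℕ → Fin (suc s)
  capFin n = fromℕ< (s≤s (m⊓n≤n n s))

  emptyM : ∀ {α} → Mult α
  emptyM = mult (replicate _ zero)

  -- the s-multiset {(A , τ)}  (one copy; s ≥ 1 is assumed in the lemma)
  singleM : ∀ {α} → Subset → Ty α → Mult α
  singleM A τ = mult (replicate _ zero [ pairIdx A τ ]≔ capFin 1)

  _∪M_ : ∀ {α} → Mult α → Mult α → Mult α
  m ∪M m' = mult (zipWith (λ x y → capFin (toℕ x + toℕ y)) (mults m) (mults m'))

  sizeM : ∀ {α} → Fin s → Mult α → ℕ
  sizeM {α} a m =
    sum (tabulate (λ i → if′ lookup (proj₁ (pairOf {α} i)) a then toℕ (lookup (mults m) i)))
    where
    if′_then_ : Bool → ℕ → ℕ
    if′ true  then n = n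
    if′ false then n = 0

  -- Type environments Γ: an s-multiset of bindings x : (A , σ) for every
  -- variable x of the term context (x ∈ dom Γ iff its multiset is nonempty).

  data Env : Ctx → Set where
    []  : Env []
    _∷_ : ∀ {σ Δ} → Mult σ → Env Δ → Env (σ ∷ Δ)

  emptyE : ∀ Δ → Env Δ
  emptyE []      = []
  emptyE (σ ∷ Δ) = emptyM ∷ emptyE Δ

  singleE : ∀ {Δ σ} → Δ ∋ σ → Subset → Ty σ → Env Δ
  singleE {σ ∷ Δ} here      A τ = singleM A τ ∷ emptyE Δ
  singleE {σ ∷ Δ} (there x) A τ = emptyM ∷ singleE x A τ

  _∪E_ : ∀ {Δ} → Env Δ → Env Δ → Env Δ
  []       ∪E []         = []
  (m ∷ Γ) ∪E (m' ∷ Γ') = (m ∪M m') ∷ (Γ ∪E Γ')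

  sizeE : ∀ {Δ} → Fin s → Env Δ → ℕ
  sizeE a []      = 0
  sizeE a (m ∷ Γ) = sizeM a m + sizeE a Γ

  -- Effects v : Σ_a → ℕ as vectors

  Eff : Set
  Eff = Vec ℕ s

  𝟎 : Eff
  𝟎 = replicate s 0

  χ : Fin s → Eff
  χ i = 𝟎 [ i ]≔ 1

  -- Index set I of an application: the copies of the pairs in m.
  -- I = { (p , j) | p a pair index, j < multiplicity of p in m }

  Idx : ∀ {α} → Mult α → Set
  Idx {α} m = Σ (Fin (2 ^ s * card α)) (λ p → Fin (toℕ (lookup (mults m) p)))

  sumIdx : ∀ {α} (m : Mult α) → (Idx m → ℕ) → ℕ
  sumIdx m f = sum (tabulate (λ p → sum (tabulate (λ j → f (p , j)))))

  ⋃E : ∀ {Δ} n → (Fin n → Env Δ) → Env Δ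
  ⋃E {Δ} zero    f = emptyE Δ
  ⋃E     (suc n) f = f zero ∪E ⋃E n (λ j → f (suc j))

  ⋃Idx : ∀ {Δ α} (m : Mult α) → (Idx m → Env Δ) → Env Δ
  ⋃Idx {α = α} m f = ⋃E (2 ^ s * card α) (λ p → ⋃E (toℕ (lookup (mults m) p)) (λ j → f (p , j)))

  Aof : ∀ {Δ} → Env Δ → Eff → Subset
  Aof Γ v = tabulate (λ a → not (lookup v a ≡ᵇ 0) ∨ not (sizeE a Γ ≡ᵇ 0))

  -- Derivable judgments  Γ ⊢ M : (v , τ)   written  Der Γ M v τ

  data Der : ∀ {Δ σ} → Env Δ → Tm Δ σ → Eff → Ty σ → Set where
    a-rule : ∀ {Δ} (i : Fin s) (A : Subset) →
             Der (emptyE Δ) (aC i) (χ i) (singleM A r , r)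
    c-rule : ∀ {Δ} → Der (emptyE Δ) cC 𝟎 r
    b-rule₁ : ∀ {Δ} (A : Subset) →
             Der (emptyE Δ) bC 𝟎 (singleM A r , (emptyM , r))
    b-rule₂ : ∀ {Δ} (A : Subset) →
             Der (emptyE Δ) bC 𝟎 (emptyM , (singleM A r , r))
    var-rule : ∀ {Δ σ} (x : Δ ∋ σ) (A : Subset) (τ : Ty σ) →
             Der (singleE x A τ) (var x) 𝟎 τ
    -- (λ): the premise environment is Γ ∪ {x : (A_i,τ_i) | i ∈ I}, x ∉ dom Γ
    lam-rule : ∀ {Δ σ τ'} {Γ : Env Δ} {m : Mult σ} {K : Tm (σ ∷ Δ) τ'} {v : Eff} {τ : Ty τ'} →
             Der (m ∷ Γ) K v τ → Der Γ (lam K) v (m , τ)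
    app-rule : ∀ {Δ σ τ'} {K : Tm Δ (σ ⇒ τ')} {L : Tm Δ σ}
             {Γ₀ : Env Δ} {v₀ : Eff} {m : Mult σ} {τ : Ty τ'}
             (Γs : Idx m → Env Δ) (vs : Idx m → Eff) →
             Der Γ₀ K v₀ (m , τ) →
             ((i : Idx m) → Der (Γs i) L (vs i) (proj₂ (pairOf {σ} (proj₁ i)))) →
             ((i : Idx m) → proj₁ (pairOf {σ} (proj₁ i)) ≡ Aof (Γs i) (vs i)) →
             Der (Γ₀ ∪E ⋃Idx m Γs) (app K L)
                 (tabulate (λ a →
                    ((sizeE a Γ₀ + sumIdx m (λ i → sizeE a (Γs i)))
                       ∸ sizeE a (Γ₀ ∪E ⋃Idx m Γs))
                    + (lookup v₀ a + sumIdx m (λ i → lookup (vs i) a))))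
                 τ

-- A closed term of sort o that is not β-normal has a redex outside every λ: a closed normal term
-- that is not a λ is a constant applied to arguments, and constants only take arguments of sort o,
-- which are never λs. Contracting such a redex only involves closed type environments, and the step
-- from (λy.K) L to K[L/y] is a substitution lemma: a derivation of K in which y is bound to the
-- s-multiset X, together with one derivation of L for each copy in X, gives a derivation of K[L/y]
-- whose effect at a exceeds the old one by at least the total effect at a of those derivations of L.
-- The delicate case is application: the cap at s in unions merges copies, so dupl drops by the
-- number of merged copies whose set contains a, and each of them is paid for by its derivation of L,
-- whose effect at a is positive exactly when a lies in the set. For the same reason an effect that
-- vanishes at a keeps vanishing.

module Submission where

open import Defs
open import Data.Nat using (ℕ; _≤_)
open import Data.Fin using (Fin)
open import Data.Vec using (lookup)
open import Data.List using ([])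
open import Data.Product using (Σ; _×_)
open import Relation.Binary.PropositionalEquality using (_≡_)
open import Relation.Nullary using (¬_)

open import Data.Nat
open import Data.Nat.Properties
open import Data.Nat.Tactic.RingSolver using (solve-∀)
open import Algebra.Properties.CommutativeSemigroup +-commutativeSemigroup using (interchange; xy∙z≈xz∙y)
open import Data.Fin using (zero; suc; toℕ; fromℕ<; inject≤; combine; remQuot)
open import Data.Fin.Properties using (toℕ<n; fromℕ<-toℕ; toℕ-fromℕ<; toℕ-inject≤; remQuot-combine)
import Data.Fin.Properties as Fin
open import Data.Vec using (Vec; []; _∷_; tabulate; sum; replicate)
open import Data.Vec.Properties
  using (lookup-zipWith; lookup-replicate; zipWith-replicate; tabulate-cong; lookup∘tabulate; lookup∘update; lookup∘update′)
open import Data.Bool using (Bool; true; false; not; _∨_)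
open import Data.Bool.Properties using (∨-identityʳ)
open import Data.Product using (_,_; proj₁; proj₂; map₁)
open import Data.Sum using (_⊎_; inj₁; inj₂; [_,_])
open import Data.Empty using (⊥-elim)
open import Data.List using (_∷_; _++_)
open import Data.List.Relation.Binary.Sublist.Propositional using (_⊆_; []; _∷_; _∷ʳ_; ⊆-refl)
open import Function using (_∘_)
open import Relation.Binary.PropositionalEquality hiding (subst; [_])
import Relation.Binary.PropositionalEquality as ≡
open import Relation.Nullary using (yes; no)

∑ : ∀ {n} → (Fin n → ℕ) → ℕ
∑ f = sum (tabulate f)

∑-cong : ∀ {n} {f g : Fin n → ℕ} → (∀ i → f i ≡ g i) → ∑ f ≡ ∑ g
∑-cong {zero}  f≗g = refl
∑-cong {suc n} f≗g = cong₂ _+_ (f≗g zero) (∑-cong (f≗g ∘ suc))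

∑-mono-≤ : ∀ {n} {f g : Fin n → ℕ} → (∀ i → f i ≤ g i) → ∑ f ≤ ∑ g
∑-mono-≤ {zero}  f≤g = z≤n
∑-mono-≤ {suc n} f≤g = +-mono-≤ (f≤g zero) (∑-mono-≤ (f≤g ∘ suc))

∑-distrib-+ : ∀ {n} (f g : Fin n → ℕ) → ∑ (λ i → f i + g i) ≡ ∑ f + ∑ g
∑-distrib-+ {zero}  f g = refl
∑-distrib-+ {suc n} f g = begin
  f zero + g zero + ∑ (λ i → f (suc i) + g (suc i))
    ≡⟨ cong (f zero + g zero +_) (∑-distrib-+ (f ∘ suc) (g ∘ suc)) ⟩
  f zero + g zero + (∑ (f ∘ suc) + ∑ (g ∘ suc))
    ≡⟨ interchange (f zero) (g zero) _ _ ⟩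
  f zero + ∑ (f ∘ suc) + (g zero + ∑ (g ∘ suc)) ∎
  where open ≡-Reasoning

∑-zero : ∀ {n} {f : Fin n → ℕ} → (∀ i → f i ≡ 0) → ∑ f ≡ 0
∑-zero {zero}  f≗0 = refl
∑-zero {suc n} f≗0 = cong₂ _+_ (f≗0 zero) (∑-zero (f≗0 ∘ suc))

∑≡0⇒≡0 : ∀ {n} (f : Fin n → ℕ) → ∑ f ≡ 0 → ∀ i → f i ≡ 0
∑≡0⇒≡0 f ∑≡0 zero    = m+n≡0⇒m≡0 (f zero) ∑≡0
∑≡0⇒≡0 f ∑≡0 (suc i) = ∑≡0⇒≡0 (f ∘ suc) (m+n≡0⇒n≡0 (f zero) ∑≡0) i

∑-lowerBound : ∀ {n} c (f : Fin n → ℕ) → (∀ i → c ≤ f i) → n * c ≤ ∑ f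
∑-lowerBound {zero}  c f c≤f = z≤n
∑-lowerBound {suc n} c f c≤f = +-mono-≤ (c≤f zero) (∑-lowerBound c (f ∘ suc) (c≤f ∘ suc))

∑-Fin0 : ∀ {n} → n ≡ 0 → (f : Fin n → ℕ) → ∑ f ≡ 0
∑-Fin0 refl f = refl

∑-Fin1 : ∀ {n} (n≡1 : n ≡ 1) (f : Fin n → ℕ) → ∑ f ≡ f (≡.subst Fin (sym n≡1) zero)
∑-Fin1 refl f = +-identityʳ (f zero)

∑-single : ∀ {n} (f : Fin n → ℕ) (i : Fin n) → (∀ j → ¬ j ≡ i → f j ≡ 0) → ∑ f ≡ f i
∑-single {suc n} f zero    f≡0 = trans (cong (f zero +_) (∑-zero (λ j → f≡0 (suc j) λ ()))) (+-identityʳ _)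
∑-single {suc n} f (suc i) f≡0 = cong₂ _+_ (f≡0 zero λ ())
  (∑-single (f ∘ suc) i (λ j j≢i → f≡0 (suc j) (j≢i ∘ Fin.suc-injective)))

Σ< : ℕ → (ℕ → ℕ) → ℕ
Σ< zero    g = 0
Σ< (suc n) g = g 0 + Σ< n (g ∘ suc)

Σ<-+ : ∀ m n g → Σ< (m + n) g ≡ Σ< m g + Σ< n (λ k → g (m + k))
Σ<-+ zero    n g = refl
Σ<-+ (suc m) n g = trans (cong (g 0 +_) (Σ<-+ m n (g ∘ suc))) (sym (+-assoc (g 0) _ _))

Σ<-lowerBound : ∀ n c g → (∀ k → c ≤ g k) → n * c ≤ Σ< n g
Σ<-lowerBound zero    c g c≤g = z≤n
Σ<-lowerBound (suc n) c g c≤g = +-mono-≤ (c≤g 0) (Σ<-lowerBound n c (g ∘ suc) (c≤g ∘ suc))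

∑≡Σ< : ∀ {n} (f : Fin n → ℕ) (g : ℕ → ℕ) → (∀ i → f i ≡ g (toℕ i)) → ∑ f ≡ Σ< n g
∑≡Σ< {zero}  f g f≗g = refl
∑≡Σ< {suc n} f g f≗g = cong₂ _+_ (f≗g zero) (∑≡Σ< (f ∘ suc) (g ∘ suc) (f≗g ∘ suc))

-- The D copies counted on both sides each weigh at least c.
Σ<-overlap : ∀ {U X} d D Y c g → (∀ k → c ≤ g k) → U ≡ d + Y → X ≡ d + D →
  Σ< U g + c * X + c * Y ≤ Σ< X g + Σ< Y (λ k → g (d + k)) + c * U
Σ<-overlap d D Y c g c≤g refl refl = begin
  Σ< (d + Y) g + c * (d + D) + c * Y
    ≡⟨ cong (λ z → z + c * (d + D) + c * Y) (Σ<-+ d Y g) ⟩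
  Σ< d g + Σ< Y g′ + c * (d + D) + c * Y
    ≡⟨ rearrange (Σ< d g) (Σ< Y g′) c d D Y ⟩
  Σ< d g + D * c + Σ< Y g′ + c * (d + Y)
    ≤⟨ +-monoˡ-≤ _ (+-monoˡ-≤ _ (+-monoʳ-≤ (Σ< d g) (Σ<-lowerBound D c g′ (c≤g ∘ (d +_))))) ⟩
  Σ< d g + Σ< D g′ + Σ< Y g′ + c * (d + Y)
    ≡⟨ cong (λ z → z + Σ< Y g′ + c * (d + Y)) (Σ<-+ d D g) ⟨
  Σ< (d + D) g + Σ< Y g′ + c * (d + Y) ∎
  where
  open ≤-Reasoning
  g′ : ℕ → ℕ
  g′ k = g (d + k)
  rearrange : ∀ a b c d D Y → a + b + c * (d + D) + c * Y ≡ a + D * c + b + c * (d + Y)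
  rearrange = solve-∀

extend : ∀ {n} → ℕ → (Fin n → ℕ) → ℕ → ℕ
extend {n} c h k with k <? n
... | yes k<n = h (fromℕ< k<n)
... | no  _   = c

extend-toℕ : ∀ {n} c (h : Fin n → ℕ) i → extend c h (toℕ i) ≡ h i
extend-toℕ {n} c h i with toℕ i <? n
... | yes i<n = cong h (fromℕ<-toℕ i i<n)
... | no  i≮n = ⊥-elim (i≮n (toℕ<n i))

extend-lowerBound : ∀ {n} c (h : Fin n → ℕ) → (∀ i → c ≤ h i) → ∀ k → c ≤ extend c h k
extend-lowerBound {n} c h c≤h k with k <? n
... | yes k<n = c≤h (fromℕ< k<n)
... | no  _   = ≤-refl

shiftTo : ∀ {U Y} → Y ≤ U → Fin Y → Fin U
shiftTo {U} {Y} Y≤U j = fromℕ< (begin-strict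
  U ∸ Y + toℕ j <⟨ +-monoʳ-< (U ∸ Y) (toℕ<n j) ⟩
  U ∸ Y + Y     ≡⟨ m∸n+n≡m Y≤U ⟩
  U             ∎)
  where open ≤-Reasoning

∑-overlap : ∀ {U} X Y c (h : Fin U → ℕ) → (∀ i → c ≤ h i) →
  (X≤U : X ≤ U) (Y≤U : Y ≤ U) → U ≤ X + Y →
  ∑ h + c * X + c * Y ≤ ∑ (λ j → h (inject≤ j X≤U)) + ∑ (λ j → h (shiftTo Y≤U j)) + c * U
∑-overlap {U} X Y c h c≤h X≤U Y≤U U≤X+Y = begin
  ∑ h + c * X + c * Y
    ≡⟨ cong (λ z → z + c * X + c * Y) (∑≡Σ< h g (sym ∘ extend-toℕ c h)) ⟩
  Σ< U g + c * X + c * Y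
    ≤⟨ Σ<-overlap d (X ∸ d) Y c g (extend-lowerBound c h c≤h) (sym (m∸n+n≡m Y≤U)) (sym (m+[n∸m]≡n d≤X)) ⟩
  Σ< X g + Σ< Y (λ k → g (d + k)) + c * U
    ≡⟨ cong₂ (λ z w → z + w + c * U) (∑≡Σ< _ g onLeft) (∑≡Σ< _ _ onRight) ⟨
  ∑ (λ j → h (inject≤ j X≤U)) + ∑ (λ j → h (shiftTo Y≤U j)) + c * U ∎
  where
  open ≤-Reasoning
  g : ℕ → ℕ
  g = extend c h
  d : ℕ
  d = U ∸ Y
  d≤X : d ≤ X
  d≤X = ≤-trans (∸-monoˡ-≤ Y U≤X+Y) (≤-reflexive (m+n∸n≡m X Y))
  onLeft : ∀ j → h (inject≤ j X≤U) ≡ g (toℕ j)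
  onLeft j = trans (sym (extend-toℕ c h _)) (cong g (toℕ-inject≤ j X≤U))
  onRight : ∀ j → h (shiftTo Y≤U j) ≡ g (d + toℕ j)
  onRight j = trans (sym (extend-toℕ c h _)) (cong g (toℕ-fromℕ< _))

telescope : ∀ {a b c d e f} → a + b ≤ c + d → d + e ≤ f + b → a + e ≤ c + f
telescope {a} {b} {c} {d} {e} {f} ab≤cd de≤fb = +-cancelʳ-≤ (b + d) (a + e) (c + f) (begin
  a + e + (b + d)      ≡⟨ shuffle a b d e ⟩
  (a + b) + (d + e)    ≤⟨ +-mono-≤ ab≤cd de≤fb ⟩
  (c + d) + (f + b)    ≡⟨ shuffle′ c d f b ⟩
  c + f + (b + d)      ∎)
  where
  open ≤-Reasoning
  shuffle : ∀ a b d e → a + e + (b + d) ≡ (a + b) + (d + e)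
  shuffle = solve-∀
  shuffle′ : ∀ c d f b → (c + d) + (f + b) ≡ c + f + (b + d)
  shuffle′ = solve-∀

∑-+-mono-≤ : ∀ {n} (f g h k : Fin n → ℕ) → (∀ i → f i + g i ≤ h i + k i) → ∑ f + ∑ g ≤ ∑ h + ∑ k
∑-+-mono-≤ f g h k pointwise = begin
  ∑ f + ∑ g                 ≡⟨ ∑-distrib-+ f g ⟨
  ∑ (λ i → f i + g i)       ≤⟨ ∑-mono-≤ pointwise ⟩
  ∑ (λ i → h i + k i)       ≡⟨ ∑-distrib-+ h k ⟩
  ∑ h + ∑ k                 ∎
  where open ≤-Reasoning

∸-+-≤ : ∀ p r q t → (p + r) ∸ (q + t) ≤ (p ∸ q) + (r ∸ t)
∸-+-≤ p r q t = m≤n+o⇒m∸n≤o (p + r) (q + t) (begin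
  p + r                             ≤⟨ +-mono-≤ (m≤n+m∸n p q) (m≤n+m∸n r t) ⟩
  (q + (p ∸ q)) + (t + (r ∸ t))     ≡⟨ interchange q (p ∸ q) t (r ∸ t) ⟩
  (q + t) + ((p ∸ q) + (r ∸ t))     ∎)
  where open ≤-Reasoning

𝟙 : Bool → ℕ
𝟙 true  = 1
𝟙 false = 0

nonzero : ℕ → Bool
nonzero n = not (n ≡ᵇ 0)

𝟙-nonzero-≤ : ∀ n → 𝟙 (nonzero n) ≤ n
𝟙-nonzero-≤ zero    = z≤n
𝟙-nonzero-≤ (suc n) = s≤s z≤n

nonzero≡false : ∀ n → nonzero n ≡ false → n ≡ 0
nonzero≡false zero _ = refl

𝟙≡0 : ∀ b → 𝟙 b ≡ 0 → b ≡ false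
𝟙≡0 false _ = refl

nonzero-cong : ∀ {m n} → m ≤ n → (m ≡ 0 → n ≡ 0) → nonzero m ≡ nonzero n
nonzero-cong {zero}  _ n≡0 rewrite n≡0 refl = refl
nonzero-cong {suc m} (s≤s _) _ = refl

nonzero-∨-transfer : ∀ p q r t → p + r ≤ t → (p ≡ 0 → r ≡ 0 → t ≡ 0) →
  (nonzero p ∨ nonzero (q + r)) ≡ (nonzero t ∨ nonzero q)
nonzero-∨-transfer (suc p) q r       (suc t) _ _ = refl
nonzero-∨-transfer zero    q (suc r) (suc t) _ _ rewrite +-suc q r = refl
nonzero-∨-transfer zero    q zero    t       _ t≡0 rewrite t≡0 refl refl | +-identityʳ q = refl

-- The duplications R ∸ T that disappear with the substituted variable are paid for by the weights W.
dupl-transfer : ∀ P Q R T v₀ Σv W W₀ SW v₀′ Σv′ → T ≤ R → W + R ≤ W₀ + SW + T →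
  v₀ + W₀ ≤ v₀′ → Σv + SW ≤ Σv′ →
  (P + R) ∸ (Q + T) + (v₀ + Σv) + W ≤ (P ∸ Q) + (v₀′ + Σv′)
dupl-transfer P Q R T v₀ Σv W W₀ SW v₀′ Σv′ T≤R paid v₀≤ Σv≤ = begin
  (P + R) ∸ (Q + T) + (v₀ + Σv) + W
    ≤⟨ +-monoˡ-≤ W (+-monoˡ-≤ (v₀ + Σv) (∸-+-≤ P R Q T)) ⟩
  (P ∸ Q) + (R ∸ T) + (v₀ + Σv) + W
    ≡⟨ shuffle (P ∸ Q) (R ∸ T) (v₀ + Σv) W ⟩
  (P ∸ Q) + ((R ∸ T) + W + (v₀ + Σv))
    ≤⟨ +-monoʳ-≤ (P ∸ Q) (+-monoˡ-≤ (v₀ + Σv) surplus) ⟩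
  (P ∸ Q) + ((W₀ + SW) + (v₀ + Σv))
    ≡⟨ cong (P ∸ Q +_) (shuffle′ W₀ SW v₀ Σv) ⟩
  (P ∸ Q) + ((v₀ + W₀) + (Σv + SW))
    ≤⟨ +-monoʳ-≤ (P ∸ Q) (+-mono-≤ v₀≤ Σv≤) ⟩
  (P ∸ Q) + (v₀′ + Σv′) ∎
  where
  open ≤-Reasoning
  shuffle : ∀ a b c w → a + b + c + w ≡ a + (b + w + c)
  shuffle = solve-∀
  shuffle′ : ∀ w₀ sw v sv → (w₀ + sw) + (v + sv) ≡ (v + w₀) + (sv + sw)
  shuffle′ = solve-∀
  surplus : (R ∸ T) + W ≤ W₀ + SW
  surplus = +-cancelʳ-≤ T _ _ (begin
    R ∸ T + W + T   ≡⟨ trans (+-assoc (R ∸ T) W T) (cong (R ∸ T +_) (+-comm W T)) ⟩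
    R ∸ T + (T + W) ≡⟨ trans (sym (+-assoc (R ∸ T) T W)) (cong (_+ W) (m∸n+n≡m T≤R)) ⟩
    R + W           ≡⟨ +-comm R W ⟩
    W + R           ≤⟨ paid ⟩
    W₀ + SW + T     ∎)

module _ (s : ℕ) where

  infixr 6 _∪_

  _∪_ : ∀ {α} → Mult s α → Mult s α → Mult s α
  _∪_ = _∪M_ s

  ∅ : ∀ {α} → Mult s α
  ∅ = emptyM s

  infixr 6 _∪ᴱ_

  _∪ᴱ_ : ∀ {Δ} → Env s Δ → Env s Δ → Env s Δ
  _∪ᴱ_ = _∪E_ s

  Pair : Sort → Set
  Pair α = Fin (2 ^ s * card s α)

  count : ∀ {α} → Mult s α → Pair α → ℕ
  count m p = toℕ (lookup (mults m) p)

  module _ {α : Sort} where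

    _∈ₚ_ : Fin s → Pair α → Bool
    a ∈ₚ p = lookup (proj₁ (pairOf s {α} p)) a

    ∣_↾_∣ : Mult s α → Fin s → ℕ
    ∣ m ↾ a ∣ = ∑ (λ p → 𝟙 (a ∈ₚ p) * count m p)

    count≤s : (m : Mult s α) (p : Pair α) → count m p ≤ s
    count≤s m p = s≤s⁻¹ (toℕ<n (lookup (mults m) p))

    count-∪ : (x y : Mult s α) (p : Pair α) → count (x ∪ y) p ≡ (count x p + count y p) ⊓ s
    count-∪ x y p = trans (cong toℕ (lookup-zipWith _ p (mults x) (mults y))) (toℕ-fromℕ< _)

    count-∅ : ∀ p → count (∅ {α}) p ≡ 0
    count-∅ p = cong toℕ (lookup-replicate p zero)

    ∅-∪ : ∅ ∪ ∅ ≡ ∅ {α}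
    ∅-∪ = cong mult (zipWith-replicate _ zero zero)

    count-∪ˡ : (x y : Mult s α) (p : Pair α) → count x p ≤ count (x ∪ y) p
    count-∪ˡ x y p = ≤-trans (⊓-glb (m≤m+n _ _) (count≤s x p)) (≤-reflexive (sym (count-∪ x y p)))

    count-∪ʳ : (x y : Mult s α) (p : Pair α) → count y p ≤ count (x ∪ y) p
    count-∪ʳ x y p = ≤-trans (⊓-glb (m≤n+m _ _) (count≤s y p)) (≤-reflexive (sym (count-∪ x y p)))

    count-∪-≤ : (x y : Mult s α) (p : Pair α) → count (x ∪ y) p ≤ count x p + count y p
    count-∪-≤ x y p = ≤-trans (≤-reflexive (count-∪ x y p)) (m⊓n≤m _ _)

    -- The summand of sizeM is a conditional local to Defs, so its statement is left to unification.
    sizeM-summand : ∀ a (m : Mult s α) p → _ ≡ 𝟙 (a ∈ₚ p) * count m p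
    sizeM≡∣↾∣ : ∀ a (m : Mult s α) → sizeM s a m ≡ ∣ m ↾ a ∣
    sizeM≡∣↾∣ a m = cong sum (tabulate-cong (sizeM-summand a m))
    sizeM-summand a m p with a ∈ₚ p
    ... | true  = sym (+-identityʳ _)
    ... | false = refl

    ∣∅↾∣ : ∀ a → ∣ ∅ {α} ↾ a ∣ ≡ 0
    ∣∅↾∣ a = ∑-zero (λ p → trans (cong (𝟙 (a ∈ₚ p) *_) (count-∅ p)) (*-zeroʳ (𝟙 (a ∈ₚ p))))

    ∣↾∣-mono : ∀ a {x y : Mult s α} → (∀ p → count x p ≤ count y p) → ∣ x ↾ a ∣ ≤ ∣ y ↾ a ∣
    ∣↾∣-mono a x≤y = ∑-mono-≤ (λ p → *-monoʳ-≤ (𝟙 (a ∈ₚ p)) (x≤y p))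

    ∣∪↾∣≤ : ∀ a (x y : Mult s α) → ∣ x ∪ y ↾ a ∣ ≤ ∣ x ↾ a ∣ + ∣ y ↾ a ∣
    ∣∪↾∣≤ a x y = begin
      ∣ x ∪ y ↾ a ∣
        ≤⟨ ∑-mono-≤ (λ p → *-monoʳ-≤ (𝟙 (a ∈ₚ p)) (count-∪-≤ x y p)) ⟩
      ∑ (λ p → 𝟙 (a ∈ₚ p) * (count x p + count y p))
        ≡⟨ ∑-cong (λ p → *-distribˡ-+ (𝟙 (a ∈ₚ p)) (count x p) (count y p)) ⟩
      ∑ (λ p → 𝟙 (a ∈ₚ p) * count x p + 𝟙 (a ∈ₚ p) * count y p)
        ≡⟨ ∑-distrib-+ (λ p → 𝟙 (a ∈ₚ p) * count x p) (λ p → 𝟙 (a ∈ₚ p) * count y p) ⟩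
      ∣ x ↾ a ∣ + ∣ y ↾ a ∣ ∎
      where open ≤-Reasoning

    sumIdx-cong : (m : Mult s α) {f g : Idx s m → ℕ} → (∀ i → f i ≡ g i) → sumIdx s m f ≡ sumIdx s m g
    sumIdx-cong m f≗g = ∑-cong (λ p → ∑-cong (λ j → f≗g (p , j)))

    sumIdx-mono-≤ : (m : Mult s α) {f g : Idx s m → ℕ} → (∀ i → f i ≤ g i) → sumIdx s m f ≤ sumIdx s m g
    sumIdx-mono-≤ m f≤g = ∑-mono-≤ (λ p → ∑-mono-≤ (λ j → f≤g (p , j)))

    sumIdx-distrib-+ : (m : Mult s α) (f g : Idx s m → ℕ) →
      sumIdx s m (λ i → f i + g i) ≡ sumIdx s m f + sumIdx s m g
    sumIdx-distrib-+ m f g =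
      trans (∑-cong (λ p → ∑-distrib-+ (λ j → f (p , j)) (λ j → g (p , j)))) (∑-distrib-+ (λ p → ∑ (λ j → f (p , j))) (λ p → ∑ (λ j → g (p , j))))

    sumIdx-zero : (m : Mult s α) {f : Idx s m → ℕ} → (∀ i → f i ≡ 0) → sumIdx s m f ≡ 0
    sumIdx-zero m f≗0 = ∑-zero (λ p → ∑-zero (λ j → f≗0 (p , j)))

    sumIdx≡0⇒≡0 : (m : Mult s α) (f : Idx s m → ℕ) → sumIdx s m f ≡ 0 → ∀ i → f i ≡ 0
    sumIdx≡0⇒≡0 m f ∑≡0 (p , j) = ∑≡0⇒≡0 (λ j → f (p , j)) (∑≡0⇒≡0 (λ p → ∑ (λ j → f (p , j))) ∑≡0 p) j

    sumIdx-∅ : (f : Idx s (∅ {α}) → ℕ) → sumIdx s (∅ {α}) f ≡ 0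
    sumIdx-∅ f = ∑-zero (λ p → ∑-Fin0 (count-∅ p) _)

    Covers : Fin s → (m : Mult s α) → (Idx s m → ℕ) → Set
    Covers a m f = ∀ i → 𝟙 (a ∈ₚ proj₁ i) ≤ f i

    ∣↾∣≤sumIdx : ∀ a (m : Mult s α) (f : Idx s m → ℕ) → Covers a m f → ∣ m ↾ a ∣ ≤ sumIdx s m f
    ∣↾∣≤sumIdx a m f cover = ∑-mono-≤ (λ p → ≤-trans (≤-reflexive (*-comm (𝟙 (a ∈ₚ p)) (count m p)))
      (∑-lowerBound _ (λ j → f (p , j)) (λ j → cover (p , j))))

    record _⇉_ (x y : Mult s α) : Set where
      constructor copies
      field at : ∀ p → Fin (count x p) → Fin (count y p)

    along : {x y : Mult s α} → x ⇉ y → Idx s x → Idx s y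
    along φ i = proj₁ i , _⇉_.at φ (proj₁ i) (proj₂ i)

    ∪-inl : (x y : Mult s α) → x ⇉ (x ∪ y)
    ∪-inl x y = copies (λ p j → inject≤ j (count-∪ˡ x y p))

    ∪-inr : (x y : Mult s α) → y ⇉ (x ∪ y)
    ∪-inr x y = copies (λ p j → shiftTo (count-∪ʳ x y p) j)

    -- Copies of x and y that the cap at s merges in x ∪ y are counted twice on the right.
    ∪-overlap : ∀ a (x y : Mult s α) (f : Idx s (x ∪ y) → ℕ) → Covers a (x ∪ y) f →
      sumIdx s (x ∪ y) f + ∣ x ↾ a ∣ + ∣ y ↾ a ∣ ≤
      sumIdx s x (f ∘ along (∪-inl x y)) + sumIdx s y (f ∘ along (∪-inr x y)) + ∣ x ∪ y ↾ a ∣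
    ∪-overlap a x y f cover = begin
      ∑ S + ∣ x ↾ a ∣ + ∣ y ↾ a ∣
        ≡⟨ cong (_+ ∣ y ↾ a ∣) (∑-distrib-+ S (λ p → c p * count x p)) ⟨
      ∑ (λ p → S p + c p * count x p) + ∣ y ↾ a ∣
        ≡⟨ ∑-distrib-+ (λ p → S p + c p * count x p) (λ p → c p * count y p) ⟨
      ∑ (λ p → S p + c p * count x p + c p * count y p)
        ≤⟨ ∑-mono-≤ (λ p → ∑-overlap (count x p) (count y p) (c p) (λ j → f (p , j)) (λ j → cover (p , j))
                             (count-∪ˡ x y p) (count-∪ʳ x y p) (count-∪-≤ x y p)) ⟩
      ∑ (λ p → L p + R p + c p * count (x ∪ y) p)
        ≡⟨ ∑-distrib-+ (λ p → L p + R p) (λ p → c p * count (x ∪ y) p) ⟩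
      ∑ (λ p → L p + R p) + ∣ x ∪ y ↾ a ∣
        ≡⟨ cong (_+ ∣ x ∪ y ↾ a ∣) (∑-distrib-+ L R) ⟩
      ∑ L + ∑ R + ∣ x ∪ y ↾ a ∣ ∎
      where
      open ≤-Reasoning
      c : Pair α → ℕ
      c p = 𝟙 (a ∈ₚ p)
      S L R : Pair α → ℕ
      S p = ∑ (λ j → f (p , j))
      L p = ∑ (λ j → f (along (∪-inl x y) (p , j)))
      R p = ∑ (λ j → f (along (∪-inr x y) (p , j)))

    _⟫_ : {x y z : Mult s α} → x ⇉ y → y ⇉ z → x ⇉ z
    φ ⟫ ψ = copies (λ p → _⇉_.at ψ p ∘ _⇉_.at φ p)

    ⋃ : ∀ n → (Fin n → Mult s α) → Mult s α
    ⋃ zero    g = ∅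
    ⋃ (suc n) g = g zero ∪ ⋃ n (g ∘ suc)

    ⋃-inj : ∀ n (g : Fin n → Mult s α) j → g j ⇉ ⋃ n g
    ⋃-inj (suc n) g zero    = ∪-inl (g zero) (⋃ n (g ∘ suc))
    ⋃-inj (suc n) g (suc j) = ⋃-inj n (g ∘ suc) j ⟫ ∪-inr (g zero) (⋃ n (g ∘ suc))

    count-⋃ : ∀ n (g : Fin n → Mult s α) j p → count (g j) p ≤ count (⋃ n g) p
    count-⋃ (suc n) g zero    p = count-∪ˡ (g zero) _ p
    count-⋃ (suc n) g (suc j) p = ≤-trans (count-⋃ n (g ∘ suc) j p) (count-∪ʳ (g zero) _ p)

    ∣⋃↾∣≤∑ : ∀ a n (g : Fin n → Mult s α) → ∣ ⋃ n g ↾ a ∣ ≤ ∑ (λ j → ∣ g j ↾ a ∣)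
    ∣⋃↾∣≤∑ a zero    g = ≤-reflexive (∣∅↾∣ a)
    ∣⋃↾∣≤∑ a (suc n) g = ≤-trans (∣∪↾∣≤ a (g zero) _) (+-monoʳ-≤ ∣ g zero ↾ a ∣ (∣⋃↾∣≤∑ a n (g ∘ suc)))

    ⋃-overlap : ∀ a n (g : Fin n → Mult s α) (f : Idx s (⋃ n g) → ℕ) → Covers a (⋃ n g) f →
      sumIdx s (⋃ n g) f + ∑ (λ j → ∣ g j ↾ a ∣) ≤
      ∑ (λ j → sumIdx s (g j) (f ∘ along (⋃-inj n g j))) + ∣ ⋃ n g ↾ a ∣
    ⋃-overlap a zero    g f cover = ≤-trans (≤-reflexive (trans (+-identityʳ _) (sumIdx-∅ f))) z≤n
    ⋃-overlap a (suc n) g f cover = begin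
      sumIdx s u f + (∣ x ↾ a ∣ + ∑ (λ j → ∣ g (suc j) ↾ a ∣))
        ≡⟨ +-assoc (sumIdx s u f) _ _ ⟨
      sumIdx s u f + ∣ x ↾ a ∣ + ∑ (λ j → ∣ g (suc j) ↾ a ∣)
        ≤⟨ telescope {d = sumIdx s R (f ∘ along (∪-inr x R))}
             (≤-trans (∪-overlap a x R f cover) (≤-reflexive (xy∙z≈xz∙y Wx _ ∣ u ↾ a ∣)))
             (⋃-overlap a n (g ∘ suc) (f ∘ along (∪-inr x R)) (cover ∘ along (∪-inr x R))) ⟩
      Wx + ∣ u ↾ a ∣ + Wrest
        ≡⟨ xy∙z≈xz∙y Wx _ Wrest ⟩
      Wx + Wrest + ∣ u ↾ a ∣ ∎
      where
      open ≤-Reasoning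
      x R u : Mult s α
      x = g zero
      R = ⋃ n (g ∘ suc)
      u = x ∪ R
      Wx Wrest : ℕ
      Wx = sumIdx s x (f ∘ along (∪-inl x R))
      Wrest = ∑ (λ j → sumIdx s (g (suc j)) (f ∘ along (⋃-inj (suc n) g (suc j))))

    module _ {β : Sort} (μ : Mult s β) (xs : Idx s μ → Mult s α) where

      private
        part : Pair β → Mult s α
        part p = ⋃ (count μ p) (λ j → xs (p , j))

      ⋃ᵢ : Mult s α
      ⋃ᵢ = ⋃ _ part

      ⋃ᵢ-inj : ∀ i → xs i ⇉ ⋃ᵢ
      ⋃ᵢ-inj (p , j) = ⋃-inj (count μ p) (λ j → xs (p , j)) j ⟫ ⋃-inj _ part p

      count-⋃ᵢ : ∀ i p → count (xs i) p ≤ count ⋃ᵢ p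
      count-⋃ᵢ (q , j) p = ≤-trans (count-⋃ (count μ q) (λ j → xs (q , j)) j p) (count-⋃ _ part q p)

      ∣⋃ᵢ↾∣≤ : ∀ a → ∣ ⋃ᵢ ↾ a ∣ ≤ sumIdx s μ (λ i → ∣ xs i ↾ a ∣)
      ∣⋃ᵢ↾∣≤ a = ≤-trans (∣⋃↾∣≤∑ a _ part) (∑-mono-≤ (λ p → ∣⋃↾∣≤∑ a (count μ p) (λ j → xs (p , j))))

      ⋃ᵢ-overlap : ∀ a (f : Idx s ⋃ᵢ → ℕ) → Covers a ⋃ᵢ f →
        sumIdx s ⋃ᵢ f + sumIdx s μ (λ i → ∣ xs i ↾ a ∣) ≤
        sumIdx s μ (λ i → sumIdx s (xs i) (f ∘ along (⋃ᵢ-inj i))) + ∣ ⋃ᵢ ↾ a ∣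
      ⋃ᵢ-overlap a f cover = ≤-trans
        (telescope {d = ∑ Wpart}
          (≤-trans (⋃-overlap a _ part f cover) (≤-reflexive (+-comm (∑ Wpart) ∣ ⋃ᵢ ↾ a ∣)))
          (∑-+-mono-≤ Wpart (λ p → ∑ (λ j → ∣ xs (p , j) ↾ a ∣))
                      (λ p → ∑ (λ j → sumIdx s (xs (p , j)) (f ∘ along (⋃ᵢ-inj (p , j)))))
                      (λ p → ∣ part p ↾ a ∣)
             (λ p → ⋃-overlap a (count μ p) (λ j → xs (p , j))
                      (f ∘ along (⋃-inj _ part p)) (cover ∘ along (⋃-inj _ part p)))))
        (≤-reflexive (+-comm ∣ ⋃ᵢ ↾ a ∣ _))
        where
        Wpart : Pair β → ℕ
        Wpart p = sumIdx s (part p) (f ∘ along (⋃-inj _ part p))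

  -- Each decoder is defined by a `with' on remQuot, which remQuot-combine resolves on codes.

  decodeSub-codeSub : ∀ {n} (A : Vec Bool n) → decodeSub s n (codeSub s A) ≡ A
  decodeSub-codeSub []               = refl
  decodeSub-codeSub {suc n} (b ∷ bs) = begin
    decodeSub s (suc n) (combine (bit s b) (codeSub s bs))
      ≡⟨ unfold (combine (bit s b) (codeSub s bs)) ⟩
    step (remQuot (2 ^ n) (combine (bit s b) (codeSub s bs)))
      ≡⟨ cong step (remQuot-combine (bit s b) (codeSub s bs)) ⟩
    (toℕ (bit s b) ≡ᵇ 1) ∷ decodeSub s n (codeSub s bs)
      ≡⟨ cong₂ _∷_ (bit-roundtrip b) (decodeSub-codeSub bs) ⟩
    b ∷ bs ∎
    where
    open ≡-Reasoning
    step : Fin 2 × Fin (2 ^ n) → Vec Bool (suc n)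
    step (x , j) = (toℕ x ≡ᵇ 1) ∷ decodeSub s n j
    unfold : ∀ i → decodeSub s (suc n) i ≡ step (remQuot (2 ^ n) i)
    unfold i with remQuot {2} (2 ^ n) i
    ... | _ = refl
    bit-roundtrip : ∀ b → (toℕ (bit s b) ≡ᵇ 1) ≡ b
    bit-roundtrip false = refl
    bit-roundtrip true  = refl

  decodeVec-codeVec : ∀ {k n} (xs : Vec (Fin k) n) → decodeVec s k n (codeVec s xs) ≡ xs
  decodeVec-codeVec []                   = refl
  decodeVec-codeVec {k} {suc n} (x ∷ xs) = begin
    decodeVec s k (suc n) (combine x (codeVec s xs))
      ≡⟨ unfold (combine x (codeVec s xs)) ⟩
    step (remQuot (k ^ n) (combine x (codeVec s xs)))
      ≡⟨ cong step (remQuot-combine x (codeVec s xs)) ⟩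
    x ∷ decodeVec s k n (codeVec s xs)
      ≡⟨ cong (x ∷_) (decodeVec-codeVec xs) ⟩
    x ∷ xs ∎
    where
    open ≡-Reasoning
    step : Fin k × Fin (k ^ n) → Vec (Fin k) (suc n)
    step (y , j) = y ∷ decodeVec s k n j
    unfold : ∀ i → decodeVec s k (suc n) i ≡ step (remQuot (k ^ n) i)
    unfold i with remQuot {k} (k ^ n) i
    ... | _ = refl

  decodeTy-codeTy : ∀ α (τ : Ty s α) → decodeTy s α (codeTy s α τ) ≡ τ
  decodeTy-codeTy o       τ       = refl
  decodeTy-codeTy (α ⇒ β) (m , τ) = begin
    decodeTy s (α ⇒ β) (combine (codeVec s (mults m)) (codeTy s β τ))
      ≡⟨ unfold (combine (codeVec s (mults m)) (codeTy s β τ)) ⟩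
    step (remQuot (card s β) (combine (codeVec s (mults m)) (codeTy s β τ)))
      ≡⟨ cong step (remQuot-combine (codeVec s (mults m)) (codeTy s β τ)) ⟩
    mult (decodeVec s (suc s) N (codeVec s (mults m))) , decodeTy s β (codeTy s β τ)
      ≡⟨ cong₂ _,_ (cong mult (decodeVec-codeVec (mults m))) (decodeTy-codeTy β τ) ⟩
    m , τ ∎
    where
    open ≡-Reasoning
    N : ℕ
    N = 2 ^ s * card s α
    step : Fin (suc s ^ N) × Fin (card s β) → Ty s (α ⇒ β)
    step (p , q) = mult (decodeVec s (suc s) N p) , decodeTy s β q
    unfold : ∀ i → decodeTy s (α ⇒ β) i ≡ step (remQuot (card s β) i)
    unfold i with remQuot {suc s ^ N} (card s β) i
    ... | _ = refl

  pairOf-pairIdx : ∀ {α} (A : Subset s) (τ : Ty s α) → pairOf s {α} (pairIdx s A τ) ≡ (A , τ)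
  pairOf-pairIdx {α} A τ = begin
    pairOf s (pairIdx s A τ)
      ≡⟨ unfold (pairIdx s A τ) ⟩
    step (remQuot (card s α) (pairIdx s A τ))
      ≡⟨ cong step (remQuot-combine (codeSub s A) (codeTy s α τ)) ⟩
    decodeSub s s (codeSub s A) , decodeTy s α (codeTy s α τ)
      ≡⟨ cong₂ _,_ (decodeSub-codeSub A) (decodeTy-codeTy α τ) ⟩
    A , τ ∎
    where
    open ≡-Reasoning
    step : Fin (2 ^ s) × Fin (card s α) → Subset s × Ty s α
    step (p , q) = decodeSub s s p , decodeTy s α q
    unfold : ∀ i → pairOf s {α} i ≡ step (remQuot (card s α) i)
    unfold i with remQuot {2 ^ s} (card s α) i
    ... | _ = refl

  module _ {α : Sort} (A : Subset s) (τ : Ty s α) where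

    count-single-≢ : ∀ p → ¬ p ≡ pairIdx s A τ → count (singleM s A τ) p ≡ 0
    count-single-≢ p p≢ = trans (cong toℕ (lookup∘update′ p≢ (replicate _ zero) (capFin s 1)))
                                (cong toℕ (lookup-replicate p zero))

    module _ (1≤s : 1 ≤ s) where

      count-single : count (singleM s A τ) (pairIdx s A τ) ≡ 1
      count-single = trans (cong toℕ (lookup∘update (pairIdx s A τ) (replicate _ zero) (capFin s 1)))
                           (trans (toℕ-fromℕ< _) (m≤n⇒m⊓n≡m 1≤s))

      theCopy : Idx s (singleM s A τ)
      theCopy = pairIdx s A τ , ≡.subst Fin (sym count-single) zero

      sumIdx-single : (f : Idx s (singleM s A τ) → ℕ) → sumIdx s (singleM s A τ) f ≡ f theCopy
      sumIdx-single f = trans (∑-single _ (pairIdx s A τ) (λ p p≢ → ∑-Fin0 (count-single-≢ p p≢) _))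
                              (∑-Fin1 count-single _)

      ∣single↾∣ : ∀ a → ∣ singleM s A τ ↾ a ∣ ≡ 𝟙 (lookup A a)
      ∣single↾∣ a = begin
        ∣ singleM s A τ ↾ a ∣
          ≡⟨ ∑-single _ (pairIdx s A τ) (λ p p≢ → trans (cong (𝟙 (_∈ₚ_ {α} a p) *_) (count-single-≢ p p≢)) (*-zeroʳ (𝟙 (_∈ₚ_ {α} a p)))) ⟩
        𝟙 (lookup (proj₁ (pairOf s {α} (pairIdx s A τ))) a) * count (singleM s A τ) (pairIdx s A τ)
          ≡⟨ cong₂ (λ q n → 𝟙 (lookup (proj₁ q) a) * n) (pairOf-pairIdx A τ) count-single ⟩
        𝟙 (lookup A a) * 1
          ≡⟨ *-identityʳ _ ⟩
        𝟙 (lookup A a) ∎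
        where open ≡-Reasoning

  cast : ∀ {Δ σ} {Γ Γ′ : Env s Δ} {T T′ : Tm s Δ σ} {v v′ : Eff s} {τ τ′ : Ty s σ} →
    Γ ≡ Γ′ → T ≡ T′ → v ≡ v′ → τ ≡ τ′ → Der s Γ T v τ → Der s Γ′ T′ v′ τ′
  cast refl refl refl refl d = d

  ⋃E-cong : ∀ {Δ} n {f g : Fin n → Env s Δ} → (∀ j → f j ≡ g j) → ⋃E s n f ≡ ⋃E s n g
  ⋃E-cong zero    f≗g = refl
  ⋃E-cong (suc n) f≗g = cong₂ _∪ᴱ_ (f≗g zero) (⋃E-cong n (f≗g ∘ suc))

  Aof-cong : ∀ {Δ Δ′} (Γ : Env s Δ) (Γ′ : Env s Δ′) v → (∀ a → sizeE s a Γ ≡ sizeE s a Γ′) → Aof s Γ v ≡ Aof s Γ′ v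
  Aof-cong Γ Γ′ v same = tabulate-cong (λ a → cong (λ n → not (lookup v a ≡ᵇ 0) ∨ not (n ≡ᵇ 0)) (same a))

  -- Definitionally the effect in the conclusion of app-rule.
  appEff : ∀ {Δ α} (m : Mult s α) (Γ₀ : Env s Δ) (Γs : Idx s m → Env s Δ) (v₀ : Eff s) (vs : Idx s m → Eff s) → Eff s
  appEff m Γ₀ Γs v₀ vs = tabulate (λ a →
    ((sizeE s a Γ₀ + sumIdx s m (λ i → sizeE s a (Γs i))) ∸ sizeE s a (Γ₀ ∪ᴱ ⋃Idx s m Γs))
    + (lookup v₀ a + sumIdx s m (λ i → lookup (vs i) a)))

  lookup-appEff : ∀ {Δ α} (m : Mult s α) Γ₀ (Γs : Idx s m → Env s Δ) v₀ vs a → lookup (appEff m Γ₀ Γs v₀ vs) a ≡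
    ((sizeE s a Γ₀ + sumIdx s m (λ i → sizeE s a (Γs i))) ∸ sizeE s a (Γ₀ ∪ᴱ ⋃Idx s m Γs))
    + (lookup v₀ a + sumIdx s m (λ i → lookup (vs i) a))
  lookup-appEff m Γ₀ Γs v₀ vs = lookup∘tabulate _

  ren⊆ : ∀ {Δ Δ′} → Δ ⊆ Δ′ → Ren s Δ Δ′
  ren⊆ (_ ∷ʳ ρ)  x         = there (ren⊆ ρ x)
  ren⊆ (refl ∷ ρ) here      = here
  ren⊆ (refl ∷ ρ) (there x) = there (ren⊆ ρ x)

  ren⊆-refl : ∀ {Δ σ} (x : Δ ∋ σ) → ren⊆ ⊆-refl x ≡ x
  ren⊆-refl here      = refl
  ren⊆-refl (there x) = cong there (ren⊆-refl x)

  pad : ∀ {Δ Δ′} → Δ ⊆ Δ′ → Env s Δ → Env s Δ′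
  pad []         []      = []
  pad (_ ∷ʳ ρ)  Γ       = ∅ ∷ pad ρ Γ
  pad (refl ∷ ρ) (m ∷ Γ) = m ∷ pad ρ Γ

  pad-empty : ∀ {Δ Δ′} (ρ : Δ ⊆ Δ′) → pad ρ (emptyE s Δ) ≡ emptyE s Δ′
  pad-empty []         = refl
  pad-empty (_ ∷ʳ ρ)  = cong (∅ ∷_) (pad-empty ρ)
  pad-empty (refl ∷ ρ) = cong (∅ ∷_) (pad-empty ρ)

  pad-single : ∀ {Δ Δ′ σ} (ρ : Δ ⊆ Δ′) (x : Δ ∋ σ) A τ → pad ρ (singleE s x A τ) ≡ singleE s (ren⊆ ρ x) A τ
  pad-single (_ ∷ʳ ρ)  x         A τ = cong (∅ ∷_) (pad-single ρ x A τ)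
  pad-single (refl ∷ ρ) here      A τ = cong (singleM s A τ ∷_) (pad-empty ρ)
  pad-single (refl ∷ ρ) (there x) A τ = cong (∅ ∷_) (pad-single ρ x A τ)

  pad-∪ : ∀ {Δ Δ′} (ρ : Δ ⊆ Δ′) (Γ Γ′ : Env s Δ) → pad ρ (Γ ∪ᴱ Γ′) ≡ pad ρ Γ ∪ᴱ pad ρ Γ′
  pad-∪ []         []      []        = refl
  pad-∪ (_ ∷ʳ ρ)  Γ       Γ′        = cong₂ _∷_ (sym ∅-∪) (pad-∪ ρ Γ Γ′)
  pad-∪ (refl ∷ ρ) (m ∷ Γ) (m′ ∷ Γ′) = cong (_ ∷_) (pad-∪ ρ Γ Γ′)

  pad-⋃E : ∀ {Δ Δ′} (ρ : Δ ⊆ Δ′) n (f : Fin n → Env s Δ) → pad ρ (⋃E s n f) ≡ ⋃E s n (pad ρ ∘ f)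
  pad-⋃E ρ zero    f = pad-empty ρ
  pad-⋃E ρ (suc n) f = trans (pad-∪ ρ (f zero) _) (cong (pad ρ (f zero) ∪ᴱ_) (pad-⋃E ρ n (f ∘ suc)))

  pad-app : ∀ {Δ Δ′ α} (ρ : Δ ⊆ Δ′) Γ₀ (m : Mult s α) (Γs : Idx s m → Env s Δ) →
    pad ρ (Γ₀ ∪ᴱ ⋃Idx s m Γs) ≡ pad ρ Γ₀ ∪ᴱ ⋃Idx s m (pad ρ ∘ Γs)
  pad-app {α = α} ρ Γ₀ m Γs = trans (pad-∪ ρ Γ₀ _) (cong (pad ρ Γ₀ ∪ᴱ_)
    (trans (pad-⋃E ρ (2 ^ s * card s α) (λ p → ⋃E s (count m p) (λ j → Γs (p , j))))
           (⋃E-cong (2 ^ s * card s α) (λ p → pad-⋃E ρ (count m p) (λ j → Γs (p , j))))))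

  sizeE-pad : ∀ {Δ Δ′} (ρ : Δ ⊆ Δ′) a (Γ : Env s Δ) → sizeE s a (pad ρ Γ) ≡ sizeE s a Γ
  sizeE-pad []         a []      = refl
  sizeE-pad (σ ∷ʳ ρ)  a Γ       = cong₂ _+_ (trans (sizeM≡∣↾∣ {σ} a ∅) (∣∅↾∣ {σ} a)) (sizeE-pad ρ a Γ)
  sizeE-pad (refl ∷ ρ) a (m ∷ Γ) = cong (sizeM s a m +_) (sizeE-pad ρ a Γ)

  rename-cong : ∀ {Δ Δ′ τ} {ρ ρ′ : Ren s Δ Δ′} → (∀ {σ} (x : Δ ∋ σ) → ρ x ≡ ρ′ x) → (T : Tm s Δ τ) →
    rename s ρ T ≡ rename s ρ′ T
  rename-cong ρ≗ρ′ (var x)   = cong var (ρ≗ρ′ x)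
  rename-cong ρ≗ρ′ (aC i)    = refl
  rename-cong ρ≗ρ′ bC        = refl
  rename-cong ρ≗ρ′ cC        = refl
  rename-cong ρ≗ρ′ ωC        = refl
  rename-cong ρ≗ρ′ (lam T)   = cong lam (rename-cong (λ { here → refl ; (there x) → cong there (ρ≗ρ′ x) }) T)
  rename-cong ρ≗ρ′ (app T U) = cong₂ app (rename-cong ρ≗ρ′ T) (rename-cong ρ≗ρ′ U)

  weaken : ∀ {Δ Δ′ σ} (ρ : Δ ⊆ Δ′) {Γ : Env s Δ} {T : Tm s Δ σ} {v τ} →
    Der s Γ T v τ → Der s (pad ρ Γ) (rename s (ren⊆ ρ) T) v τ
  weaken ρ (a-rule i A)     = cast (sym (pad-empty ρ)) refl refl refl (a-rule i A)
  weaken ρ c-rule           = cast (sym (pad-empty ρ)) refl refl refl c-rule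
  weaken ρ (b-rule₁ A)      = cast (sym (pad-empty ρ)) refl refl refl (b-rule₁ A)
  weaken ρ (b-rule₂ A)      = cast (sym (pad-empty ρ)) refl refl refl (b-rule₂ A)
  weaken ρ (var-rule x A τ) = cast (sym (pad-single ρ x A τ)) refl refl refl (var-rule (ren⊆ ρ x) A τ)
  weaken ρ (lam-rule {K = K} d) =
    lam-rule (cast refl (rename-cong (λ { here → refl ; (there x) → refl }) K) refl refl (weaken (refl ∷ ρ) d))
  weaken ρ (app-rule {Γ₀ = Γ₀} {v₀ = v₀} {m = m} Γs vs d ds A≡) =
    cast (sym (pad-app ρ Γ₀ m Γs)) refl (tabulate-cong sameEffect) refl
      (app-rule (pad ρ ∘ Γs) vs (weaken ρ d) (weaken ρ ∘ ds)
        (λ i → trans (A≡ i) (Aof-cong (Γs i) (pad ρ (Γs i)) (vs i) (λ a → sym (sizeE-pad ρ a (Γs i))))))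
    where
    sameEffect : ∀ a → _
    sameEffect a = cong (_+ (lookup v₀ a + sumIdx s m (λ i → lookup (vs i) a)))
      (cong₂ _∸_ (cong₂ _+_ (sizeE-pad ρ a Γ₀) (sumIdx-cong m (λ i → sizeE-pad ρ a (Γs i))))
                 (trans (cong (sizeE s a) (sym (pad-app ρ Γ₀ m Γs))) (sizeE-pad ρ a _)))

  weaken-empty : ∀ {Δ σ τ} {T : Tm s Δ σ} {v t} → Der s (emptyE s Δ) T v t →
    Der s (emptyE s (τ ∷ Δ)) (rename s there T) v t
  weaken-empty {Δ} {T = T} d =
    cast (cong (∅ ∷_) (pad-empty ⊆-refl)) (rename-cong (cong there ∘ ren⊆-refl) T) refl refl
      (weaken (_ ∷ʳ ⊆-refl) d)

  module _ (σ : Sort) where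

    infixl 25 _▷
    infixr 6 _⊕_

    _▷ : Ctx → Ctx
    Δ ▷ = Δ ++ σ ∷ []

    inj▷ : ∀ Δ {τ} → Δ ∋ τ → Δ ▷ ∋ τ
    inj▷ (ρ ∷ Δ) here      = here
    inj▷ (ρ ∷ Δ) (there y) = there (inj▷ Δ y)

    last▷ : ∀ Δ → Δ ▷ ∋ σ
    last▷ []      = here
    last▷ (ρ ∷ Δ) = there (last▷ Δ)

    data View▷ (Δ : Ctx) : ∀ {τ} → Δ ▷ ∋ τ → Set where
      isInj  : ∀ {τ} (y : Δ ∋ τ) → View▷ Δ (inj▷ Δ y)
      isLast : View▷ Δ (last▷ Δ)

    view▷ : ∀ Δ {τ} (x : Δ ▷ ∋ τ) → View▷ Δ x
    view▷ []      here       = isLast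
    view▷ (ρ ∷ Δ) here       = isInj here
    view▷ (ρ ∷ Δ) (there x) with view▷ Δ x
    ... | isInj y = isInj (there y)
    ... | isLast  = isLast

    Split : Ctx → Set
    Split Δ = Env s Δ × Mult s σ

    split : ∀ Δ → Env s (Δ ▷) → Split Δ
    split []      (m ∷ []) = [] , m
    split (ρ ∷ Δ) (m ∷ Γ)  = map₁ (m ∷_) (split Δ Γ)

    _⊕_ : ∀ {Δ} → Split Δ → Split Δ → Split Δ
    P ⊕ P′ = proj₁ P ∪ᴱ proj₁ P′ , proj₂ P ∪ proj₂ P′

    ⨁ : ∀ {Δ} n → (Fin n → Split Δ) → Split Δ
    ⨁ n P = ⋃E s n (proj₁ ∘ P) , ⋃ n (proj₂ ∘ P)

    ⨁-cong : ∀ {Δ} n {P P′ : Fin n → Split Δ} → (∀ j → P j ≡ P′ j) → ⨁ n P ≡ ⨁ n P′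
    ⨁-cong zero    P≗P′ = refl
    ⨁-cong (suc n) P≗P′ = cong₂ _⊕_ (P≗P′ zero) (⨁-cong n (P≗P′ ∘ suc))

    split-empty : ∀ Δ → split Δ (emptyE s (Δ ▷)) ≡ (emptyE s Δ , ∅)
    split-empty []      = refl
    split-empty (ρ ∷ Δ) = cong (map₁ (∅ ∷_)) (split-empty Δ)

    split-inj : ∀ Δ {τ} (y : Δ ∋ τ) A t → split Δ (singleE s (inj▷ Δ y) A t) ≡ (singleE s y A t , ∅)
    split-inj (ρ ∷ Δ) here      A t = cong (map₁ (singleM s A t ∷_)) (split-empty Δ)
    split-inj (ρ ∷ Δ) (there y) A t = cong (map₁ (∅ ∷_)) (split-inj Δ y A t)

    split-last : ∀ Δ A t → split Δ (singleE s (last▷ Δ) A t) ≡ (emptyE s Δ , singleM s A t)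
    split-last []      A t = refl
    split-last (ρ ∷ Δ) A t = cong (map₁ (∅ ∷_)) (split-last Δ A t)

    split-∪ : ∀ Δ (Γ Γ′ : Env s (Δ ▷)) → split Δ (Γ ∪ᴱ Γ′) ≡ split Δ Γ ⊕ split Δ Γ′
    split-∪ []      (m ∷ []) (m′ ∷ []) = refl
    split-∪ (ρ ∷ Δ) (m ∷ Γ)  (m′ ∷ Γ′) = cong (map₁ (_ ∷_)) (split-∪ Δ Γ Γ′)

    split-⋃E : ∀ Δ n (f : Fin n → Env s (Δ ▷)) → split Δ (⋃E s n f) ≡ ⨁ n (split Δ ∘ f)
    split-⋃E Δ zero    f = split-empty Δ
    split-⋃E Δ (suc n) f = trans (split-∪ Δ (f zero) _) (cong (split Δ (f zero) ⊕_) (split-⋃E Δ n (f ∘ suc)))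

    split-app : ∀ Δ {α} Γ₀ (μ : Mult s α) (Γs : Idx s μ → Env s (Δ ▷)) →
      split Δ (Γ₀ ∪ᴱ ⋃Idx s μ Γs) ≡
      split Δ Γ₀ ⊕ (⋃Idx s μ (proj₁ ∘ split Δ ∘ Γs) , ⋃ᵢ μ (proj₂ ∘ split Δ ∘ Γs))
    split-app Δ {α} Γ₀ μ Γs = trans (split-∪ Δ Γ₀ _) (cong (split Δ Γ₀ ⊕_)
      (trans (split-⋃E Δ _ _) (⨁-cong (2 ^ s * card s α) (λ p → split-⋃E Δ (count μ p) (λ j → Γs (p , j))))))

    sizeE-split : ∀ Δ a (Γ : Env s (Δ ▷)) → sizeE s a Γ ≡ sizeE s a (proj₁ (split Δ Γ)) + ∣ proj₂ (split Δ Γ) ↾ a ∣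
    sizeE-split []      a (m ∷ []) = trans (+-identityʳ _) (sizeM≡∣↾∣ a m)
    sizeE-split (ρ ∷ Δ) a (m ∷ Γ)  = trans (cong (sizeM s a m +_) (sizeE-split Δ a Γ)) (sym (+-assoc (sizeM s a m) _ _))

    record Arg (Δ : Ctx) (L : Tm s Δ σ) (p : Pair σ) : Set where
      field
        eff : Eff s
        der : Der s (emptyE s Δ) L eff (proj₂ (pairOf s {σ} p))
        set : ∀ a → lookup (proj₁ (pairOf s {σ} p)) a ≡ nonzero (lookup eff a)

    -- The premises of app-rule for the argument of the redex: one derivation per copy of a binding of the variable.
    Args : ∀ Δ → Tm s Δ σ → Mult s σ → Set
    Args Δ L x = (i : Idx s x) → Arg Δ L (proj₁ i)

    weight : ∀ {Δ L} x → Args Δ L x → Fin s → ℕ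
    weight x F a = sumIdx s x (λ i → lookup (Arg.eff (F i)) a)

    Args-covers : ∀ {Δ L} a x (F : Args Δ L x) → Covers a x (λ i → lookup (Arg.eff (F i)) a)
    Args-covers a x F i = ≡.subst (λ b → 𝟙 b ≤ lookup (Arg.eff (F i)) a) (sym (Arg.set (F i) a)) (𝟙-nonzero-≤ _)

    ∣↾∣≤weight : ∀ {Δ L} a x (F : Args Δ L x) → ∣ x ↾ a ∣ ≤ weight x F a
    ∣↾∣≤weight a x F = ∣↾∣≤sumIdx a x (λ i → lookup (Arg.eff (F i)) a) (Args-covers a x F)

    restrict : ∀ {Δ L} {x y : Mult s σ} → x ⇉ y → Args Δ L y → Args Δ L x
    restrict φ F = F ∘ along φ

    weaken-Args : ∀ {Δ ρ L x} → Args Δ L x → Args (ρ ∷ Δ) (rename s there L) x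
    weaken-Args F i = record { eff = Arg.eff (F i) ; der = weaken-empty (Arg.der (F i)) ; set = Arg.set (F i) }

    Grows : Eff s → Eff s → ℕ → ℕ → Fin s → Set
    Grows v v′ w n a = (lookup v a + w ≤ lookup v′ a) × (lookup v a ≡ 0 → n ≡ 0 → lookup v′ a ≡ 0)

    record Substituted Δ {τ′} (G : Env s Δ) (T : Tm s Δ τ′) (v : Eff s) (τ : Ty s τ′)
                       (x : Mult s σ) {L} (F : Args Δ L x) : Set where
      constructor substituted
      field
        eff′  : Eff s
        der′  : Der s G T eff′ τ
        grows : ∀ a → Grows v eff′ (weight x F a) (∣ x ↾ a ∣) a

    untouched : ∀ {Δ τ′} {G G′ : Env s Δ} {x} {T : Tm s Δ τ′} {v τ L} → (G′ , ∅) ≡ (G , x) →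
      Der s G′ T v τ → (F : Args Δ L x) → Substituted Δ G T v τ x F
    untouched {v = v} refl d F = substituted v d (λ a →
      ≤-reflexive (trans (cong (lookup v a +_) (sumIdx-∅ {σ} (λ i → lookup (Arg.eff (F i)) a))) (+-identityʳ _)) , λ v≡0 _ → v≡0)

    substitute-last : ∀ {Δ} (1≤s : 1 ≤ s) A t {G x L} → (emptyE s Δ , singleM s A t) ≡ (G , x) →
      (F : Args Δ L x) → Substituted Δ G L (𝟎 s) t x F
    substitute-last {Δ} 1≤s A t {L = L} refl F = substituted (Arg.eff arg)
      (cast refl refl refl (cong proj₂ (pairOf-pairIdx A t)) (Arg.der arg))
      (λ a → ≤-reflexive (cong₂ _+_ (lookup-replicate a 0) (sumIdx-single A t 1≤s (λ i → lookup (Arg.eff (F i)) a))) , λ _ → vanishes a)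
      where
      arg : Arg Δ L (pairIdx s A t)
      arg = F (theCopy A t 1≤s)
      vanishes : ∀ a → ∣ singleM s A t ↾ a ∣ ≡ 0 → lookup (Arg.eff arg) a ≡ 0
      vanishes a ∣↾∣≡0 = nonzero≡false _ (begin
        nonzero (lookup (Arg.eff arg) a)        ≡⟨ Arg.set arg a ⟨
        lookup (proj₁ (pairOf s {σ} (pairIdx s A t))) a ≡⟨ cong (λ q → lookup (proj₁ q) a) (pairOf-pairIdx A t) ⟩
        lookup A a                              ≡⟨ 𝟙≡0 _ (trans (sym (∣single↾∣ A t 1≤s a)) ∣↾∣≡0) ⟩
        false                                   ∎)
        where open ≡-Reasoning

    Aof-substituted : ∀ Δ (Γ : Env s (Δ ▷)) {L} (F : Args Δ L (proj₂ (split Δ Γ))) v v′ →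
      (∀ a → Grows v v′ (weight (proj₂ (split Δ Γ)) F a) (∣ proj₂ (split Δ Γ) ↾ a ∣) a) →
      Aof s Γ v ≡ Aof s (proj₁ (split Δ Γ)) v′
    Aof-substituted Δ Γ F v v′ grows = tabulate-cong (λ a → trans
      (cong (λ n → nonzero (lookup v a) ∨ nonzero n) (sizeE-split Δ a Γ))
      (nonzero-∨-transfer (lookup v a) (sizeE s a (proj₁ (split Δ Γ))) (∣ proj₂ (split Δ Γ) ↾ a ∣) (lookup v′ a)
        (≤-trans (+-monoʳ-≤ (lookup v a) (∣↾∣≤weight a (proj₂ (split Δ Γ)) F)) (proj₁ (grows a)))
        (proj₂ (grows a))))

    module AppSplit {Δ α} (Γ₀ : Env s (Δ ▷)) (μ : Mult s α) (Γs : Idx s μ → Env s (Δ ▷)) where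

      G₀ : Env s Δ
      G₀ = proj₁ (split Δ Γ₀)

      x₀ X x : Mult s σ
      x₀ = proj₂ (split Δ Γ₀)
      X  = ⋃ᵢ μ (proj₂ ∘ split Δ ∘ Γs)
      x  = x₀ ∪ X

      Gs : Idx s μ → Env s Δ
      Gs = proj₁ ∘ split Δ ∘ Γs

      xs : Idx s μ → Mult s σ
      xs = proj₂ ∘ split Δ ∘ Γs

      -- In app-rule, dupl is (P + R) ∸ (Q + T) before the substitution and P ∸ Q after it.
      P Q R T : Fin s → ℕ
      P a = sizeE s a G₀ + sumIdx s μ (λ i → sizeE s a (Gs i))
      Q a = sizeE s a (G₀ ∪ᴱ ⋃Idx s μ Gs)
      R a = ∣ x₀ ↾ a ∣ + sumIdx s μ (λ i → ∣ xs i ↾ a ∣)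
      T a = ∣ x ↾ a ∣

      lookup-appEff-split : ∀ v₀ vs a → lookup (appEff μ Γ₀ Γs v₀ vs) a ≡
        (P a + R a) ∸ (Q a + T a) + (lookup v₀ a + sumIdx s μ (λ i → lookup (vs i) a))
      lookup-appEff-split v₀ vs a = trans (lookup-appEff μ Γ₀ Γs v₀ vs a)
        (cong (_+ (lookup v₀ a + sumIdx s μ (λ i → lookup (vs i) a))) (cong₂ _∸_ premises union))
        where
        premises : sizeE s a Γ₀ + sumIdx s μ (λ i → sizeE s a (Γs i)) ≡ P a + R a
        premises = begin
          sizeE s a Γ₀ + sumIdx s μ (λ i → sizeE s a (Γs i))
            ≡⟨ cong₂ _+_ (sizeE-split Δ a Γ₀) (sumIdx-cong μ (λ i → sizeE-split Δ a (Γs i))) ⟩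
          (sizeE s a G₀ + ∣ x₀ ↾ a ∣) + sumIdx s μ (λ i → sizeE s a (Gs i) + ∣ xs i ↾ a ∣)
            ≡⟨ cong (sizeE s a G₀ + ∣ x₀ ↾ a ∣ +_) (sumIdx-distrib-+ μ _ _) ⟩
          (sizeE s a G₀ + ∣ x₀ ↾ a ∣) + (sumIdx s μ (λ i → sizeE s a (Gs i)) + sumIdx s μ (λ i → ∣ xs i ↾ a ∣))
            ≡⟨ interchange (sizeE s a G₀) _ _ _ ⟩
          P a + R a ∎
          where open ≡-Reasoning
        union : sizeE s a (Γ₀ ∪ᴱ ⋃Idx s μ Γs) ≡ Q a + T a
        union = trans (sizeE-split Δ a _)
          (cong (λ p → sizeE s a (proj₁ p) + ∣ proj₂ p ↾ a ∣) (split-app Δ Γ₀ μ Γs))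

      T≤R : ∀ a → T a ≤ R a
      T≤R a = ≤-trans (∣∪↾∣≤ a x₀ X) (+-monoʳ-≤ (∣ x₀ ↾ a ∣) (∣⋃ᵢ↾∣≤ μ xs a))

      ∣x₀↾∣≤T : ∀ a → ∣ x₀ ↾ a ∣ ≤ T a
      ∣x₀↾∣≤T a = ∣↾∣-mono a {x₀} {x} (count-∪ˡ x₀ X)

      ∣xs↾∣≤T : ∀ i a → ∣ xs i ↾ a ∣ ≤ T a
      ∣xs↾∣≤T i a = ∣↾∣-mono a {xs i} {x} (λ p → ≤-trans (count-⋃ᵢ μ xs i p) (count-∪ʳ x₀ X p))

      module _ {L : Tm s Δ σ} (F : Args Δ L x) where

        F₀ : Args Δ L x₀
        F₀ = restrict (∪-inl x₀ X) F

        Fs : ∀ i → Args Δ L (xs i)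
        Fs i = restrict (⋃ᵢ-inj μ xs i) (restrict (∪-inr x₀ X) F)

        SW : Fin s → ℕ
        SW a = sumIdx s μ (λ i → weight (xs i) (Fs i) a)

        paid : ∀ a → weight x F a + R a ≤ weight x₀ F₀ a + SW a + T a
        paid a = begin
          weight x F a + (∣ x₀ ↾ a ∣ + sumIdx s μ (λ i → ∣ xs i ↾ a ∣))
            ≡⟨ +-assoc (weight x F a) _ _ ⟨
          weight x F a + ∣ x₀ ↾ a ∣ + sumIdx s μ (λ i → ∣ xs i ↾ a ∣)
            ≤⟨ telescope {d = weight X FX a}
                 (≤-trans (∪-overlap a x₀ X (λ i → lookup (Arg.eff (F i)) a) (Args-covers a x F))
                          (≤-reflexive (xy∙z≈xz∙y (weight x₀ F₀ a) _ (T a))))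
                 (⋃ᵢ-overlap μ xs a (λ i → lookup (Arg.eff (FX i)) a) (Args-covers a X FX)) ⟩
          weight x₀ F₀ a + T a + SW a
            ≡⟨ xy∙z≈xz∙y (weight x₀ F₀ a) (T a) (SW a) ⟩
          weight x₀ F₀ a + SW a + T a ∎
          where
          open ≤-Reasoning
          FX : Args Δ L X
          FX = restrict (∪-inr x₀ X) F

        module _ (v₀ v₀′ : Eff s) (vs vs′ : Idx s μ → Eff s)
                 (grows₀ : ∀ a → Grows v₀ v₀′ (weight x₀ F₀ a) ∣ x₀ ↾ a ∣ a)
                 (growsᵢ : ∀ i a → Grows (vs i) (vs′ i) (weight (xs i) (Fs i) a) ∣ xs i ↾ a ∣ a) where

          Σvs Σvs′ : Fin s → ℕ
          Σvs  a = sumIdx s μ (λ i → lookup (vs i) a)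
          Σvs′ a = sumIdx s μ (λ i → lookup (vs′ i) a)

          appEff-bound : ∀ a → lookup (appEff μ Γ₀ Γs v₀ vs) a + weight x F a ≤ lookup (appEff μ G₀ Gs v₀′ vs′) a
          appEff-bound a = begin
            lookup (appEff μ Γ₀ Γs v₀ vs) a + weight x F a
              ≡⟨ cong (_+ weight x F a) (lookup-appEff-split v₀ vs a) ⟩
            (P a + R a) ∸ (Q a + T a) + (lookup v₀ a + Σvs a) + weight x F a
              ≤⟨ dupl-transfer (P a) (Q a) (R a) (T a) (lookup v₀ a) (Σvs a) (weight x F a) (weight x₀ F₀ a) (SW a)
                   (lookup v₀′ a) (Σvs′ a) (T≤R a) (paid a) (proj₁ (grows₀ a))
                   (≤-trans (≤-reflexive (sym (sumIdx-distrib-+ μ _ _))) (sumIdx-mono-≤ μ (λ i → proj₁ (growsᵢ i a)))) ⟩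
            (P a ∸ Q a) + (lookup v₀′ a + Σvs′ a)
              ≡⟨ lookup-appEff μ G₀ Gs v₀′ vs′ a ⟨
            lookup (appEff μ G₀ Gs v₀′ vs′) a ∎
            where open ≤-Reasoning

          appEff-vanishes : ∀ a → lookup (appEff μ Γ₀ Γs v₀ vs) a ≡ 0 → T a ≡ 0 → lookup (appEff μ G₀ Gs v₀′ vs′) a ≡ 0
          appEff-vanishes a old≡0 T≡0 =
            trans (lookup-appEff μ G₀ Gs v₀′ vs′ a) (cong₂ _+_ dupl≡0 (cong₂ _+_ v₀′≡0 Σvs′≡0))
            where
            old≡0′ : (P a + R a) ∸ (Q a + T a) + (lookup v₀ a + Σvs a) ≡ 0
            old≡0′ = trans (sym (lookup-appEff-split v₀ vs a)) old≡0
            v₀+Σvs≡0 : lookup v₀ a + Σvs a ≡ 0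
            v₀+Σvs≡0 = m+n≡0⇒n≡0 ((P a + R a) ∸ (Q a + T a)) old≡0′
            ∣x₀↾∣≡0 : ∣ x₀ ↾ a ∣ ≡ 0
            ∣x₀↾∣≡0 = n≤0⇒n≡0 (≤-trans (∣x₀↾∣≤T a) (≤-reflexive T≡0))
            ∣xs↾∣≡0 : ∀ i → ∣ xs i ↾ a ∣ ≡ 0
            ∣xs↾∣≡0 i = n≤0⇒n≡0 (≤-trans (∣xs↾∣≤T i a) (≤-reflexive T≡0))
            dupl≡0 : P a ∸ Q a ≡ 0
            dupl≡0 = begin
              P a ∸ Q a                 ≡⟨ cong₂ _∸_ (+-identityʳ (P a)) (+-identityʳ (Q a)) ⟨
              (P a + 0) ∸ (Q a + 0)     ≡⟨ cong₂ (λ r t → (P a + r) ∸ (Q a + t))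
                                                 (cong₂ _+_ ∣x₀↾∣≡0 (sumIdx-zero μ ∣xs↾∣≡0)) T≡0 ⟨
              (P a + R a) ∸ (Q a + T a) ≡⟨ m+n≡0⇒m≡0 _ old≡0′ ⟩
              0                         ∎
              where open ≡-Reasoning
            v₀′≡0 : lookup v₀′ a ≡ 0
            v₀′≡0 = proj₂ (grows₀ a) (m+n≡0⇒m≡0 _ v₀+Σvs≡0) ∣x₀↾∣≡0
            Σvs′≡0 : Σvs′ a ≡ 0
            Σvs′≡0 = sumIdx-zero μ (λ i → proj₂ (growsᵢ i a)
              (sumIdx≡0⇒≡0 μ _ (m+n≡0⇒n≡0 (lookup v₀ a) v₀+Σvs≡0) i) (∣xs↾∣≡0 i))

        app-substituted : ∀ {τ′} {K′ : Tm s Δ (α ⇒ τ′)} {L′ : Tm s Δ α} {v₀ vs τ} →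
          (∀ i → proj₁ (pairOf s {α} (proj₁ i)) ≡ Aof s (Γs i) (vs i)) →
          Substituted Δ G₀ K′ v₀ (μ , τ) x₀ F₀ →
          ((i : Idx s μ) → Substituted Δ (Gs i) L′ (vs i) (proj₂ (pairOf s {α} (proj₁ i))) (xs i) (Fs i)) →
          Substituted Δ (G₀ ∪ᴱ ⋃Idx s μ Gs) (app K′ L′) (appEff μ Γ₀ Γs v₀ vs) τ x F
        app-substituted {v₀ = v₀} {vs} A≡ (substituted v₀′ dK grows₀) results =
          substituted (appEff μ G₀ Gs v₀′ vs′)
            (app-rule Gs vs′ dK (Substituted.der′ ∘ results)
              (λ i → trans (A≡ i) (Aof-substituted Δ (Γs i) (Fs i) (vs i) (vs′ i) (growsᵢ i))))
            (λ a → appEff-bound v₀ v₀′ vs vs′ grows₀ growsᵢ a , appEff-vanishes v₀ v₀′ vs vs′ grows₀ growsᵢ a)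
          where
          vs′ : Idx s μ → Eff s
          vs′ = Substituted.eff′ ∘ results
          growsᵢ : ∀ i a → Grows (vs i) (vs′ i) (weight (xs i) (Fs i) a) ∣ xs i ↾ a ∣ a
          growsᵢ = Substituted.grows ∘ results

    substitution : ∀ Δ (1≤s : 1 ≤ s) {τ′} {Γ : Env s (Δ ▷)} {K : Tm s (Δ ▷) τ′} {v τ} → Der s Γ K v τ →
      (θ : Sub s (Δ ▷) Δ) → (∀ {ρ} (y : Δ ∋ ρ) → θ (inj▷ Δ y) ≡ var y) →
      ∀ {G x} → split Δ Γ ≡ (G , x) → (F : Args Δ (θ (last▷ Δ)) x) → Substituted Δ G (subst s θ K) v τ x F
    substitution Δ 1≤s (a-rule i A) θ θ-inj Γ≡ = untouched (trans (sym (split-empty Δ)) Γ≡) (a-rule i A)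
    substitution Δ 1≤s c-rule       θ θ-inj Γ≡ = untouched (trans (sym (split-empty Δ)) Γ≡) c-rule
    substitution Δ 1≤s (b-rule₁ A)  θ θ-inj Γ≡ = untouched (trans (sym (split-empty Δ)) Γ≡) (b-rule₁ A)
    substitution Δ 1≤s (b-rule₂ A)  θ θ-inj Γ≡ = untouched (trans (sym (split-empty Δ)) Γ≡) (b-rule₂ A)
    substitution Δ 1≤s (var-rule z A t) θ θ-inj Γ≡ with view▷ Δ z
    ... | isInj y = untouched (trans (sym (split-inj Δ y A t)) Γ≡)
                      (≡.subst (λ T → Der s _ T _ t) (sym (θ-inj y)) (var-rule y A t))
    ... | isLast  = substitute-last 1≤s A t (trans (sym (split-last Δ A t)) Γ≡)
    substitution Δ 1≤s (lam-rule {m = m} d) θ θ-inj {x = x} Γ≡ F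
      with substitution (_ ∷ Δ) 1≤s d (extS s θ) θ-inj′ (cong (map₁ (m ∷_)) Γ≡) (weaken-Args {x = x} F)
      where
      θ-inj′ : ∀ {ρ} (y : (_ ∷ Δ) ∋ ρ) → extS s θ (inj▷ (_ ∷ Δ) y) ≡ var y
      θ-inj′ here      = refl
      θ-inj′ (there y) = cong (rename s there) (θ-inj y)
    ... | substituted v′ d′ grows = substituted v′ (lam-rule d′) grows
    substitution Δ 1≤s (app-rule {Γ₀ = Γ₀} {m = μ} Γs vs dK dL A≡) θ θ-inj Γ≡ F
      with trans (sym (split-app Δ Γ₀ μ Γs)) Γ≡
    ... | refl = app-substituted F A≡
      (substitution Δ 1≤s dK θ θ-inj refl (F₀ F))
      (λ i → substitution Δ 1≤s (dL i) θ θ-inj refl (Fs F i))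
      where open AppSplit Γ₀ μ Γs

  infix 4 _≼_ _⟶ₒ_

  _≼_ : Eff s → Eff s → Set
  v ≼ v′ = (a : Fin s) → (lookup v a ≤ lookup v′ a) × (lookup v a ≡ 0 → lookup v′ a ≡ 0)

  ≼-refl : ∀ {v} → v ≼ v
  ≼-refl a = ≤-refl , λ v≡0 → v≡0

  Env[]-unique : (Γ : Env s []) → Γ ≡ []
  Env[]-unique [] = refl

  lookup-appEff-closed : ∀ {α} (μ : Mult s α) Γ₀ (Γs : Idx s μ → Env s []) v₀ vs a →
    lookup (appEff μ Γ₀ Γs v₀ vs) a ≡ lookup v₀ a + sumIdx s μ (λ i → lookup (vs i) a)
  lookup-appEff-closed μ Γ₀ Γs v₀ vs a = trans (lookup-appEff μ Γ₀ Γs v₀ vs a)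
    (cong (_+ (lookup v₀ a + sumIdx s μ (λ i → lookup (vs i) a)))
      (trans (cong (_∸ sizeE s a (Γ₀ ∪ᴱ ⋃Idx s μ Γs))
                   (cong₂ _+_ (sizeE-closed Γ₀) (sumIdx-zero μ (λ i → sizeE-closed (Γs i)))))
             (0∸n≡0 (sizeE s a (Γ₀ ∪ᴱ ⋃Idx s μ Γs)))))
    where
    sizeE-closed : (Γ : Env s []) → sizeE s a Γ ≡ 0
    sizeE-closed [] = refl

  app-≼ : ∀ {α} (μ : Mult s α) {Γ₀ Γ₀′ : Env s []} {Γs Γs′ : Idx s μ → Env s []} {v₀ v₀′ vs vs′} →
    v₀ ≼ v₀′ → (∀ i → vs i ≼ vs′ i) → appEff μ Γ₀ Γs v₀ vs ≼ appEff μ Γ₀′ Γs′ v₀′ vs′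
  app-≼ μ {Γ₀} {Γ₀′} {Γs} {Γs′} {v₀} {v₀′} {vs} {vs′} v₀≼ vs≼ a
    rewrite lookup-appEff-closed μ Γ₀ Γs v₀ vs a | lookup-appEff-closed μ Γ₀′ Γs′ v₀′ vs′ a =
      +-mono-≤ (proj₁ (v₀≼ a)) (sumIdx-mono-≤ μ (λ i → proj₁ (vs≼ i a))) ,
      λ sum≡0 → cong₂ _+_ (proj₂ (v₀≼ a) (m+n≡0⇒m≡0 _ sum≡0))
        (sumIdx-zero μ (λ i → proj₂ (vs≼ i a) (sumIdx≡0⇒≡0 μ _ (m+n≡0⇒n≡0 (lookup v₀ a) sum≡0) i)))

  Aof-≼ : ∀ (Γ Γ′ : Env s []) {v v′} → v ≼ v′ → Aof s Γ v ≡ Aof s Γ′ v′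
  Aof-≼ [] [] v≼ = tabulate-cong (λ a → cong (_∨ nonzero 0) (nonzero-cong (proj₁ (v≼ a)) (proj₂ (v≼ a))))

  data _⟶ₒ_ : ∀ {τ} → Tm s [] τ → Tm s [] τ → Set where
    top : ∀ {α β} {K : Tm s (α ∷ []) β} {L : Tm s [] α} → app (lam K) L ⟶ₒ _[_] s K L
    stl : ∀ {α β} {K K′ : Tm s [] (α ⇒ β)} {L : Tm s [] α} → K ⟶ₒ K′ → app K L ⟶ₒ app K′ L
    str : ∀ {α β} {K : Tm s [] (α ⇒ β)} {L L′ : Tm s [] α} → L ⟶ₒ L′ → app K L ⟶ₒ app K L′

  ⟶ₒ⇒⟶β : ∀ {τ} {T N : Tm s [] τ} → T ⟶ₒ N → _⟶β_ s T N
  ⟶ₒ⇒⟶β top        = beta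
  ⟶ₒ⇒⟶β (stl step) = ξl (⟶ₒ⇒⟶β step)
  ⟶ₒ⇒⟶β (str step) = ξr (⟶ₒ⇒⟶β step)

  subst-cong : ∀ {Δ Δ′ τ} {θ θ′ : Sub s Δ Δ′} → (∀ {ρ} (x : Δ ∋ ρ) → θ x ≡ θ′ x) → (T : Tm s Δ τ) →
    subst s θ T ≡ subst s θ′ T
  subst-cong θ≗θ′ (var x)   = θ≗θ′ x
  subst-cong θ≗θ′ (aC i)    = refl
  subst-cong θ≗θ′ bC        = refl
  subst-cong θ≗θ′ cC        = refl
  subst-cong θ≗θ′ ωC        = refl
  subst-cong θ≗θ′ (lam T)   = cong lam (subst-cong (λ { here → refl ; (there x) → cong (rename s there) (θ≗θ′ x) }) T)
  subst-cong θ≗θ′ (app T U) = cong₂ app (subst-cong θ≗θ′ T) (subst-cong θ≗θ′ U)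

  Reduct : ∀ {τ′} → Tm s [] τ′ → Eff s → Ty s τ′ → Set
  Reduct N v τ = Σ (Eff s) (λ v′ → Der s (emptyE s []) N v′ τ × v ≼ v′)

  contract : 1 ≤ s → ∀ {α β} (K : Tm s (α ∷ []) β) (L : Tm s [] α) {Γ v τ} →
    Der s Γ (app (lam K) L) v τ → Reduct (_[_] s K L) v τ
  contract 1≤s {α} K L (app-rule {Γ₀ = []} {v₀ = v₀} {m = μ} Γs vs (lam-rule d) dL A≡) =
    Substituted.eff′ result ,
    cast refl (subst-cong (λ { here → refl ; (there ()) }) K) refl refl (Substituted.der′ result) ,
    λ a → grows a {Substituted.eff′ result} (Substituted.grows result a)
    where
    θ : Sub s (α ∷ []) []
    θ here = L
    F : Args α [] L μ
    F i = record
      { eff = vs i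
      ; der = cast (Env[]-unique (Γs i)) refl refl refl (dL i)
      ; set = λ a → trans (cong (λ A → lookup A a) (A≡ i))
                (trans (lookup∘tabulate _ a)
                  (trans (cong (nonzero (lookup (vs i) a) ∨_) (nonzero-sizeE-closed (Γs i) a)) (∨-identityʳ _)))
      }
      where
      nonzero-sizeE-closed : (Γ : Env s []) → ∀ a → nonzero (sizeE s a Γ) ≡ false
      nonzero-sizeE-closed [] a = refl
    result : Substituted α [] [] (subst s θ K) v₀ _ μ F
    result = substitution α [] 1≤s d θ (λ ()) refl F
    grows : ∀ a {v′} → Grows α v₀ v′ (weight α μ F a) (∣ μ ↾ a ∣) a →
      (lookup (appEff μ [] Γs v₀ vs) a ≤ lookup v′ a) × (lookup (appEff μ [] Γs v₀ vs) a ≡ 0 → lookup v′ a ≡ 0)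
    grows a (bound , vanishes) rewrite lookup-appEff-closed μ [] Γs v₀ vs a =
      bound , λ sum≡0 → vanishes (m+n≡0⇒m≡0 _ sum≡0)
        (n≤0⇒n≡0 (≤-trans (∣↾∣≤weight α a μ F) (≤-reflexive (m+n≡0⇒n≡0 (lookup v₀ a) sum≡0))))

  subject-reduction : 1 ≤ s → ∀ {τ′} {T N : Tm s [] τ′} → T ⟶ₒ N → ∀ {Γ v τ} → Der s Γ T v τ → Reduct N v τ
  subject-reduction 1≤s (top {K = K} {L}) d = contract 1≤s K L d
  subject-reduction 1≤s (stl step) (app-rule {Γ₀ = Γ₀} {v₀ = v₀} {m = μ} Γs vs dK dL A≡) with subject-reduction 1≤s step dK
  ... | v₀′ , dK′ , v₀≼ =
    appEff μ [] Γs v₀′ vs , cast (Env[]-unique _) refl refl refl (app-rule Γs vs dK′ dL A≡) ,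
    app-≼ μ {Γ₀} {[]} {Γs} {Γs} {v₀} {v₀′} {vs} {vs} v₀≼ (λ i → ≼-refl {vs i})
  subject-reduction 1≤s (str step) (app-rule {Γ₀ = Γ₀} {v₀ = v₀} {m = μ} Γs vs dK dL A≡) =
    appEff μ Γ₀ (λ _ → []) v₀ vs′ ,
    cast (Env[]-unique _) refl refl refl
      (app-rule (λ _ → []) vs′ dK (proj₁ ∘ proj₂ ∘ reducts) (λ i → trans (A≡ i) (Aof-≼ (Γs i) [] {vs i} {vs′ i} (vs≼ i)))) ,
    app-≼ μ {Γ₀} {Γ₀} {Γs} {λ _ → []} {v₀} {v₀} {vs} {vs′} (≼-refl {v₀}) vs≼
    where
    reducts : ∀ i → Reduct _ (vs i) (proj₂ (pairOf s (proj₁ i)))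
    reducts i = subject-reduction 1≤s step (dL i)
    vs′ : Idx s μ → Eff s
    vs′ = proj₁ ∘ reducts
    vs≼ : ∀ i → vs i ≼ vs′ i
    vs≼ = proj₂ ∘ proj₂ ∘ reducts

  data NonLam : ∀ {τ} → Tm s [] τ → Set where
    aC  : ∀ {i} → NonLam (aC i)
    bC  : NonLam bC
    cC  : NonLam cC
    ωC  : NonLam ωC
    app : ∀ {α β} {K : Tm s [] (α ⇒ β)} {L} → NonLam (app K L)

  data LamView : ∀ {τ} → Tm s [] τ → Set where
    isLam  : ∀ {α β} (K : Tm s (α ∷ []) β) → LamView (lam K)
    notLam : ∀ {τ} {T : Tm s [] τ} → NonLam T → LamView T

  lamView : ∀ {τ} (T : Tm s [] τ) → LamView T
  lamView (aC i)    = notLam aC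
  lamView bC        = notLam bC
  lamView cC        = notLam cC
  lamView ωC        = notLam ωC
  lamView (lam K)   = isLam K
  lamView (app K L) = notLam app

  nonLam-o : (T : Tm s [] o) → NonLam T
  nonLam-o cC        = cC
  nonLam-o ωC        = ωC
  nonLam-o (app K L) = app

  -- A closed normal term that is not a λ is a constant applied to arguments.
  data ConstantSort : Sort → Set where
    o⁰ : ConstantSort o
    o¹ : ConstantSort (o ⇒ o)
    o² : ConstantSort (o ⇒ o ⇒ o)

  constantSort : ∀ {κ} (K : Tm s [] κ) → NonLam K → ¬ HasRedex s K → ConstantSort κ
  constantSort (aC i)    _ _  = o¹
  constantSort bC        _ _  = o²
  constantSort cC        _ _  = o⁰
  constantSort ωC        _ _  = o⁰
  constantSort (app K L) _ nf with lamView K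
  ... | isLam K₀ = ⊥-elim (nf redex)
  ... | notLam nlK with constantSort K nlK (nf ∘ inL)
  ...   | o¹ = o⁰
  ...   | o² = o¹

  argument-o : ∀ {α β} → ConstantSort (α ⇒ β) → α ≡ o
  argument-o o¹ = refl
  argument-o o² = refl

  redex-in-app : ∀ {α β} {K : Tm s [] (α ⇒ β)} {L : Tm s [] α} → NonLam K → HasRedex s (app K L) →
    HasRedex s K ⊎ HasRedex s L
  redex-in-app _ (inL r) = inj₁ r
  redex-in-app _ (inR r) = inj₂ r

  outer-or-normal : ∀ {τ} (T : Tm s [] τ) → NonLam T → Σ (Tm s [] τ) (T ⟶ₒ_) ⊎ ¬ HasRedex s T
  outer-or-normal (aC i)    _ = inj₂ (λ ())
  outer-or-normal bC        _ = inj₂ (λ ())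
  outer-or-normal cC        _ = inj₂ (λ ())
  outer-or-normal ωC        _ = inj₂ (λ ())
  outer-or-normal (app K L) _ with lamView K
  ... | isLam K₀ = inj₁ (_ , top)
  ... | notLam nlK with outer-or-normal K nlK
  ...   | inj₁ (K′ , step) = inj₁ (app K′ L , stl step)
  ...   | inj₂ nfK with argument-o (constantSort K nlK nfK)
  ...     | refl with outer-or-normal L (nonLam-o L)
  ...       | inj₁ (L′ , step) = inj₁ (app K L′ , str step)
  ...       | inj₂ nfL = inj₂ ([ nfK , nfL ] ∘ redex-in-app nlK)

lemma9 : (s : ℕ) → 1 ≤ s →
    (M : Tm s [] o) (v : Eff s) →
    Der s (emptyE s []) M v (r s) →
    ¬ BetaNormal s M →
    Σ (Tm s [] o) (λ N → _⟶β_ s M N ×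
      Σ (Eff s) (λ v′ → Der s (emptyE s []) N v′ (r s) ×
        ((a : Fin s) → (lookup v a ≤ lookup v′ a) × (lookup v a ≡ 0 → lookup v′ a ≡ 0))))
lemma9 s 1≤s M v d not-normal with outer-or-normal s M (nonLam-o s M)
... | inj₁ (N , step) = N , ⟶ₒ⇒⟶β s step , subject-reduction s 1≤s step d
... | inj₂ normal     = ⊥-elim (not-normal normal)
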